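{- Let $A$ be a centrosymmetric $\{0,1,-1\}$-matrix whose cell graph is a forest (has no cycles), and let $\mathcal{C}=\mathrm{Geom}(A)$. Then $$\liminf_{n\to\infty}\,|\mathcal{C}^{rc}_{2n}|^{1/n}\;\ge\;\lim_{n\to\infty}|\mathcal{C}_n|^{1/n}.$$
   Context: Permutations and classes: a permutation of size $n$ is a bijection of $[n]=\{1,\dots,n\}$. A permutation $\pi$ contains $\sigma$ if some subsequence of $\pi(1)\cdots\pi(n)$ has the same relative order as $\sigma$. A permutation class is a set of permutations closed downward under containment. $\mathcal{C}_n$ denotes the set of size-$n$ elements of $\mathcal{C}$. Reverse–complement: for $\pi$ of size $n$, $\mathrm{rc}(\pi)(i)=n+1-\pi(n+1-i)$, i.e. the diagram of $\pi$ rotated by a half turn. $\pi$ is centrosymmetric if $\mathrm{rc}(\pi)=\pi$. $\mathcal{C}^{rc}_n$ is the set of centrosymmetric elements of $\mathcal{C}_n$. A class is rc-invariant if $\mathrm{rc}(\mathcal{C})=\mathcal{C}$. Geometric grid classes: let $A$ be an $r\times c$ matrix with entries in $\{0,1,-1\}$ (row 1 at the top). Its standard figure is the subset of $[0,c]\times[0,r]$ obtained by placing in the unit square of cell $(i,j)$ (the square $[j-1,j]\times[r-i,r-i+1]$) the diagonal segment of slope $1$ if $A_{i,j}=1$, the diagonal segment of slope $-1$ if $A_{i,j}=-1$, and nothing if $A_{i,j}=0$. A set of $n$ points on the standard figure, no two sharing an $x$- or $y$-coordinate, determines the size-$n$ permutation whose diagram has the same relative order of points; $\mathrm{Geom}(A)$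 is the set of all permutations obtained this way (it is a permutation class, and $\lim_{n\to\infty}|\mathrm{Geom}(A)_n|^{1/n}$ is known to exist). $A$ is centrosymmetric if $A_{i,j}=A_{r+1-i,\,c+1-j}$ for all $i,j$. The cell graph of $A$ has the non-zero cells of $A$ as vertices, two cells being adjacent if they lie in the same row or same column and no non-zero cell lies between them in that row or column. -}

module Defs where

open import Data.Nat using (ℕ; zero; suc; _+_; _*_; _∸_; _^_; _≤_; _<_)
open import Data.Fin using (Fin; toℕ; opposite)
import Data.Fin as F
open import Data.Vec using (Vec; lookup)
open import Data.List using (List; length; []; _∷_)
open import Data.List.Relation.Unary.All using (All)
open import Data.List.Relation.Unary.Unique.Propositional using (Unique)
open import Data.Product using (Σ; ∃; _×_; _,_)
open import Data.Sum using (_⊎_)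
open import Relation.Binary.PropositionalEquality using (_≡_; _≢_)
open import Relation.Nullary using (¬_)
open import Data.Empty using (⊥)
open import Function.Bundles using (_⇔_)

-- {0,1,-1}-matrices (row 0 is the TOP row; indices are 0-based)

data Entry : Set where
  zer pos neg : Entry

Matrix : ℕ → ℕ → Set
Matrix r c = Fin r → Fin c → Entry

Centrosymmetric : ∀ {r c} → Matrix r c → Set
Centrosymmetric {r} {c} A = ∀ (i : Fin r) (j : Fin c) → A i j ≡ A (opposite i) (opposite j)

Cell : ℕ → ℕ → Set
Cell r c = Fin r × Fin c

NonZeroCell : ∀ {r c} → Matrix r c → Cell r c → Set
NonZeroCell A (i , j) = A i j ≢ zer

StrictlyBetween : ℕ → ℕ → ℕ → Set
StrictlyBetween a b k = (a < k × k < b) ⊎ (b < k × k < a)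

-- adjacency in the cell graph (both endpoints are assumed non-zero separately)
Adjacent : ∀ {r c} → Matrix r c → Cell r c → Cell r c → Set
Adjacent {r} {c} A (i , j) (i' , j') =
    (i ≡ i' × j ≢ j' × (∀ (k : Fin c) → StrictlyBetween (toℕ j) (toℕ j') (toℕ k) → A i k ≡ zer))
  ⊎ (j ≡ j' × i ≢ i' × (∀ (k : Fin r) → StrictlyBetween (toℕ i) (toℕ i') (toℕ k) → A k j ≡ zer))

-- consecutive elements of the list v₀ ∷ v₁ ∷ … ∷ vₖ are adjacent, and vₖ is adjacent to v₀
PathFrom : ∀ {r c} → Matrix r c → Cell r c → List (Cell r c) → Cell r c → Set
PathFrom A start [] last = Adjacent A last start
PathFrom A start (v ∷ vs) last = Adjacent A last v × PathFrom A start vs v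

IsCycle : ∀ {r c} → Matrix r c → List (Cell r c) → Set
IsCycle A [] = ⊥
IsCycle A (v ∷ vs) =
  3 ≤ length (v ∷ vs) × Unique (v ∷ vs) × All (NonZeroCell A) (v ∷ vs) × PathFrom A v vs v

CellGraphIsForest : ∀ {r c} → Matrix r c → Set
CellGraphIsForest {r} {c} A = ¬ (Σ (List (Cell r c)) (IsCycle A))

-- Permutations of size n: the word π(1)…π(n), 0-based, as a vector

Perm : ℕ → Set
Perm n = Vec (Fin n) n

IsPerm : ∀ {n} → Perm n → Set
IsPerm {n} π = ∀ (i j : Fin n) → lookup π i ≡ lookup π j → i ≡ j

IsCentrosymmetricPerm : ∀ {n} → Perm n → Set
IsCentrosymmetricPerm {n} π = ∀ (i : Fin n) → lookup π i ≡ opposite (lookup π (opposite i))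

-- Geometric grid class, via the standard figure scaled by a factor N ≥ 1
-- (points with coordinates in (1/N)ℤ)
-- Cell (i,j) (0-based, row 0 on top) is the square [j, j+1] × [r-1-i, r-i].

OnFigure : ∀ {r c} → Matrix r c → ℕ → ℕ → ℕ → Set
OnFigure {r} {c} A N x y =
  ∃ λ (i : Fin r) → ∃ λ (j : Fin c) →
    let x₀ = toℕ j * N
        y₀ = (r ∸ suc (toℕ i)) * N
    in x₀ ≤ x × x ≤ x₀ + N × y₀ ≤ y × y ≤ y₀ + N ×
       ((A i j ≡ pos × y + x₀ ≡ x + y₀) ⊎ (A i j ≡ neg × x + y ≡ x₀ + N + y₀))

InGeom : ∀ {r c n} → Matrix r c → Perm n → Set
InGeom {r} {c} {n} A π =
  IsPerm π ×
  ∃ λ (m : ℕ) → ∃ λ (x : Fin n → ℕ) → ∃ λ (y : Fin n → ℕ) →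
    (∀ (k l : Fin n) → toℕ k < toℕ l → x k < x l) ×
    (∀ (k l : Fin n) → (y k < y l) ⇔ (lookup π k F.< lookup π l)) ×
    (∀ (k : Fin n) → OnFigure A (suc m) (x k) (y k))

InGeomRC : ∀ {r c n} → Matrix r c → Perm n → Set
InGeomRC A π = InGeom A π × IsCentrosymmetricPerm π

AtLeast : ∀ {n} → (Perm n → Set) → ℕ → Set
AtLeast {n} P k = Σ (List (Perm n)) λ l → Unique l × All P l × k ≤ length l

-- A halving of A chooses for every column and every row one of its two halves, compatibly with the
-- diagonals of the non-zero cells and invariantly under the half-turn.  Choosing column halves is a
-- 2-colouring of the cell graph in which a row step between entries of opposite signs changes colour:
-- it exists because the cell graph is a forest, and it can be taken symmetric because every walk from
-- a cell to its rotated image makes an even number of such steps.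
-- Drawing a permutation π ∈ Geom(A) of size n in the chosen halves and its half-turn image in the other
-- halves gives a centrosymmetric permutation of size 2n in Geom(A); it determines π once the number of
-- points of π in each column is known.  Hence |C_n| ≤ (n+1)^c |C^rc_{2n}|, and the polynomial factor
-- does not affect exponential growth rates.

module Submission where

open import Defs
open import Level using (0ℓ)
open import Algebra.Bundles using (CommutativeRing)
open import Data.Bool using (Bool; true; false; not; _xor_; _∧_; if_then_else_)
open import Data.Bool.Properties
  using (xor-assoc; xor-comm; xor-same; xor-identityˡ; xor-identityʳ; true-xor; ∧-identityʳ; ∧-zeroʳ;
         not-involutive; not-¬; xor-∧-commutativeRing)
  renaming (_≟_ to _≟ᴮ_)
open import Data.Empty using (⊥; ⊥-elim)
open import Data.Fin using (Fin; zero; suc; toℕ; fromℕ<; opposite; combine; punchOut; _↑ˡ_; _↑ʳ_; splitAt)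
open import Data.Fin.Properties
  using (toℕ<n; toℕ-injective; toℕ-fromℕ<; toℕ-combine; toℕ-↑ˡ; toℕ-↑ʳ; combine-injective; opposite-prop;
         opposite-involutive; splitAt-↑ˡ; splitAt-↑ʳ; splitAt⁻¹-↑ˡ; splitAt⁻¹-↑ʳ; punchOut-injective; injective⇒≤;
         _≟_; any?; all?)
open import Data.List using (List; []; _∷_; _++_; length; map; allFin; find; cartesianProduct; cartesianProductWith; deduplicate)
open import Data.List.Properties using (length-++; length-map; length-tabulate)
open import Data.List.Membership.Propositional using (_∈_; lose)
open import Data.List.Membership.Propositional.Properties
  using (∈-∃++; ∈-++⁺ˡ; ∈-++⁺ʳ; ∈-++⁻; ∈-map⁺; ∈-map⁻; ∈-allFin; ∈-cartesianProduct⁺; ∈-cartesianProductWith⁺;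
         ∈-deduplicate⁺; ∈-deduplicate⁻)
open import Data.List.Relation.Unary.All using (All; []; _∷_)
import Data.List.Relation.Unary.All as All
open import Data.List.Relation.Unary.All.Properties using (++⁻ˡ; ++⁻ʳ; ¬Any⇒All¬)
open import Data.List.Relation.Unary.AllPairs using ([]; _∷_)
open import Data.List.Relation.Unary.Any using (here; there; satisfied) renaming (any? to anyᴸ?)
open import Data.List.Relation.Unary.Unique.Propositional using (Unique)
open import Data.Maybe using (Maybe; just; maybe)
open import Data.Nat using (ℕ; zero; suc; pred; _+_; _*_; _∸_; _^_; _⊔_; _≤_; _<_; _<?_; _≤?_; z≤n; s≤s; >-nonZero)
open import Data.Nat.Properties
  using (*-assoc; *-cancelʳ-≤; *-cancelˡ-≤; *-comm; *-identityʳ; *-mono-<; *-monoʳ-≤; *-monoˡ-≤; +-cancelˡ-<; +-cancelˡ-≡;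
         +-comm; +-mono-<; +-monoʳ-<; +-monoʳ-≤; +-monoˡ-≤; +-suc; +-∸-assoc; 1+n≰n; <-asym; <-cmp; <-irrefl; <-trans;
         <-≤-trans; <⇒≤; ^-monoˡ-≤; m+[n∸m]≡n; m+n∸m≡n; m+n∸n≡m; m<n⇒m<1+n; m^n>0; m^n≢0; m∸n≤m; m≤m+n; m≤n+m;
         m≤n+o⇒m∸n≤o; m≤n⇒m<n∨m≡n; m≤n⇒m≤1+n; n<1+n; n≢0⇒n>0; n≮0; suc-injective; ∸-monoʳ-<; ≤-<-trans;
         ≤-antisym; ≤-pred; ≤-refl; ≤-reflexive; ≤-trans; ≤∧≢⇒<; ≮⇒≥; m≤m⊔n; m≤n⊔m; +-commutativeSemigroup;
         module ≤-Reasoning)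
  renaming (_≟_ to _≟ℕ_)
open import Data.Nat.Tactic.RingSolver using (solve-∀)
open import Data.Product using (Σ; ∃; _,_; _×_; proj₁; proj₂)
open import Data.Product.Properties using () renaming (≡-dec to ×-≡-dec)
open import Data.Sum using (_⊎_; inj₁; inj₂; [_,_]′)
open import Data.Unit using (⊤; tt)
open import Data.Vec using (Vec; []; _∷_; lookup; tabulate)
open import Data.Vec.Properties using (lookup∘tabulate; tabulate∘lookup; tabulate-cong) renaming (≡-dec to Vec-≡-dec)
open import Function using (_∘_; _∘′_)
open import Function.Bundles using (_⇔_; mk⇔; Equivalence)
open import Function.Definitions using (Injective)
open import Relation.Binary using (Rel; DecidableEquality; tri<; tri≈; tri>)
open import Relation.Binary.Construct.Closure.ReflexiveTransitive using (Star; ε; _◅_; _◅◅_; gmap; revApp; reverse)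
open import Relation.Binary.PropositionalEquality
open import Relation.Nullary using (¬_; Dec; yes; no; does)
open import Relation.Nullary.Decidable
  using (¬?; _×-dec_; _⊎-dec_; dec-true; dec-false; does-⇔; map′; decidable-stable; ¬¬-excluded-middle)
open import Relation.Nullary.Negation using (¬¬-map)
open import Relation.Unary using (Pred; Decidable)
open import Algebra.Properties.CommutativeSemigroup (CommutativeRing.+-commutativeSemigroup xor-∧-commutativeRing)
  using () renaming (interchange to xor-interchange)
open import Algebra.Properties.CommutativeSemigroup +-commutativeSemigroup
  using () renaming (interchange to +-interchange)

opposite-injective : ∀ {n} {i i′ : Fin n} → opposite i ≡ opposite i′ → i ≡ i′
opposite-injective {i = i} {i′} eq =
  trans (sym (opposite-involutive i)) (trans (cong opposite eq) (opposite-involutive i′))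

opposite-reverses-< : ∀ {n} {i i′ : Fin n} → toℕ i < toℕ i′ → toℕ (opposite i′) < toℕ (opposite i)
opposite-reverses-< {i = i} {i′} i<i′ rewrite opposite-prop i | opposite-prop i′ = ∸-monoʳ-< (s≤s i<i′) (toℕ<n i′)

opposite-<ˡ : ∀ {n} {i j : Fin n} → toℕ (opposite i) < toℕ j → toℕ (opposite j) < toℕ i
opposite-<ˡ {i = i} {j} lt = subst (λ x → toℕ (opposite j) < toℕ x) (opposite-involutive i) (opposite-reverses-< lt)

opposite-<ʳ : ∀ {n} {i j : Fin n} → toℕ i < toℕ (opposite j) → toℕ j < toℕ (opposite i)
opposite-<ʳ {i = i} {j} lt = subst (λ x → toℕ x < toℕ (opposite i)) (opposite-involutive j) (opposite-reverses-< lt)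

suc-toℕ-+-opposite : ∀ {n} (i : Fin n) → suc (toℕ i + toℕ (opposite i)) ≡ n
suc-toℕ-+-opposite {suc n} i rewrite opposite-prop i = cong suc (m+[n∸m]≡n (≤-pred (toℕ<n i)))

module _ {X : Set} where

  private
    ∈-remove : ∀ (as bs : List X) {x y} → y ∈ as ++ x ∷ bs → y ≢ x → y ∈ as ++ bs
    ∈-remove as bs y∈ y≢x with ∈-++⁻ as y∈
    ... | inj₁ y∈as = ∈-++⁺ˡ y∈as
    ... | inj₂ (here y≡x) = ⊥-elim (y≢x y≡x)
    ... | inj₂ (there y∈bs) = ∈-++⁺ʳ as y∈bs

  Unique-⊆⇒length≤ : ∀ {xs ys : List X} → Unique xs → (∀ {z} → z ∈ xs → z ∈ ys) → length xs ≤ length ys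
  Unique-⊆⇒length≤ {[]} _ _ = z≤n
  Unique-⊆⇒length≤ {x ∷ xs} (x∉xs ∷ unique) xs⊆ys with ∈-∃++ (xs⊆ys (here refl))
  ... | as , bs , refl = ≤-trans (s≤s (Unique-⊆⇒length≤ unique xs⊆as++bs)) (≤-reflexive length-split)
    where
    xs⊆as++bs : ∀ {z} → z ∈ xs → z ∈ as ++ bs
    xs⊆as++bs z∈xs = ∈-remove as bs (xs⊆ys (there z∈xs)) (λ z≡x → All.lookup x∉xs z∈xs (sym z≡x))
    length-split : suc (length (as ++ bs)) ≡ length (as ++ x ∷ bs)
    length-split = begin
      suc (length (as ++ bs))        ≡⟨ cong suc (length-++ as) ⟩
      suc (length as + length bs)    ≡⟨ +-suc (length as) (length bs) ⟨
      length as + length (x ∷ bs)    ≡⟨ length-++ as ⟨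
      length (as ++ x ∷ bs)          ∎
      where open ≡-Reasoning

length-cartesianProductWith : ∀ {X Y Z : Set} (f : X → Y → Z) (xs : List X) (ys : List Y) →
                              length (cartesianProductWith f xs ys) ≡ length xs * length ys
length-cartesianProductWith f [] ys = refl
length-cartesianProductWith f (x ∷ xs) ys =
  trans (length-++ (map (f x) ys)) (cong₂ _+_ (length-map (f x) ys) (length-cartesianProductWith f xs ys))

vectors : ∀ {X : Set} → List X → (n : ℕ) → List (Vec X n)
vectors xs zero = [] ∷ []
vectors xs (suc n) = cartesianProductWith _∷_ xs (vectors xs n)

∈-vectors : ∀ {X : Set} {xs : List X} → (∀ x → x ∈ xs) → ∀ {n} (v : Vec X n) → v ∈ vectors xs n
∈-vectors complete [] = here refl
∈-vectors complete (x ∷ v) = ∈-cartesianProductWith⁺ _∷_ (complete x) (∈-vectors complete v)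

length-vectors : ∀ {X : Set} (xs : List X) n → length (vectors xs n) ≡ length xs ^ n
length-vectors xs zero = refl
length-vectors xs (suc n) = trans (length-cartesianProductWith _∷_ xs (vectors xs n)) (cong (length xs *_) (length-vectors xs n))

module _ {X Y V : Set} {P : X → Set} {Q : Y → Set} (_≟_ : DecidableEquality Y)
         (f : ∀ {x} → P x → Y × V) (f-injective : ∀ {x x′} (p : P x) (p′ : P x′) → f p ≡ f p′ → x ≡ x′)
         (f-Q : ∀ {x} (p : P x) → Q (proj₁ (f p))) {vs : List V} (∈-vs : ∀ v → v ∈ vs) where

  private
    images : ∀ {xs} → All P xs → List (Y × V)
    images [] = []
    images (p ∷ ps) = f p ∷ images ps

    length-images : ∀ {xs} (ps : All P xs) → length (images ps) ≡ length xs
    length-images [] = refl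
    length-images (p ∷ ps) = cong suc (length-images ps)

    images-Q : ∀ {xs} (ps : All P xs) → All (Q ∘′ proj₁) (images ps)
    images-Q [] = []
    images-Q (p ∷ ps) = f-Q p ∷ images-Q ps

    images-avoid : ∀ {x xs} (p : P x) (ps : All P xs) → All (x ≢_) xs → All (f p ≢_) (images ps)
    images-avoid p [] [] = []
    images-avoid p (p′ ∷ ps) (x≢x′ ∷ x∉xs) = (x≢x′ ∘′ f-injective p p′) ∷ images-avoid p ps x∉xs

    images-unique : ∀ {xs} (ps : All P xs) → Unique xs → Unique (images ps)
    images-unique [] [] = []
    images-unique (p ∷ ps) (x∉xs ∷ unique) = images-avoid p ps x∉xs ∷ images-unique ps unique

  injection-bound : ∀ {xs} → Unique xs → All P xs → Σ (List Y) λ ys → Unique ys × All Q ys × length xs ≤ length ys * length vs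
  injection-bound {xs} unique ps = ys , deduplicate-! (map proj₁ (images ps)) , All.tabulate ys-Q , bound
    where
    open import Data.List.Relation.Unary.Unique.DecPropositional.Properties _≟_ using (deduplicate-!)
    ys : List Y
    ys = deduplicate _≟_ (map proj₁ (images ps))
    ys-Q : ∀ {y} → y ∈ ys → Q y
    ys-Q y∈ys with ∈-map⁻ proj₁ (∈-deduplicate⁻ _≟_ (map proj₁ (images ps)) y∈ys)
    ... | z , z∈images , refl = All.lookup (images-Q ps) z∈images
    images⊆ : ∀ {z} → z ∈ images ps → z ∈ cartesianProduct ys vs
    images⊆ {y , v} z∈images = ∈-cartesianProduct⁺ (∈-deduplicate⁺ _≟_ (∈-map⁺ proj₁ z∈images)) (∈-vs v)
    bound : length xs ≤ length ys * length vs
    bound = begin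
      length xs                          ≡⟨ length-images ps ⟨
      length (images ps)                 ≤⟨ Unique-⊆⇒length≤ (images-unique ps unique) images⊆ ⟩
      length (cartesianProduct ys vs)    ≡⟨ length-cartesianProductWith _,_ ys vs ⟩
      length ys * length vs              ∎
      where open ≤-Reasoning

Weighting : Set → Set
Weighting V = V → V → Bool

SymmetricWeighting : ∀ {V} → Weighting V → Set
SymmetricWeighting ω = ∀ a b → ω a b ≡ ω b a

module _ {V : Set} {E : Rel V 0ℓ} where

  weight : Weighting V → ∀ {a b} → Star E a b → Bool
  weight ω ε = false
  weight ω (_◅_ {a} {b} _ W) = ω a b xor weight ω W

  starts : ∀ {a b} → Star E a b → List V
  starts ε = []
  starts (_◅_ {a} _ W) = a ∷ starts W

  targets : ∀ {a b} → Star E a b → List V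
  targets ε = []
  targets (_◅_ {_} {b} _ W) = b ∷ targets W

  vertices : ∀ {a b} → Star E a b → List V
  vertices {a} W = a ∷ targets W

  vertices-◅◅ : ∀ {a b c} (P : Star E a b) (Q : Star E b c) → vertices (P ◅◅ Q) ≡ starts P ++ vertices Q
  vertices-◅◅ ε Q = refl
  vertices-◅◅ (_◅_ {a} _ P) Q = cong (a ∷_) (vertices-◅◅ P Q)

  end∈targets : ∀ {a b c} (e : E a b) (P : Star E b c) → c ∈ targets (e ◅ P)
  end∈targets e ε = here refl
  end∈targets e (e′ ◅ P) = there (end∈targets e′ P)

  split-at : ∀ {a b c} (P : Star E a c) → b ∈ vertices P →
             Σ (Star E a b) λ P₁ → Σ (Star E b c) λ P₂ → P ≡ P₁ ◅◅ P₂
  split-at P (here refl) = ε , P , refl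
  split-at (e ◅ P) (there b∈P) with split-at P b∈P
  ... | P₁ , P₂ , refl = e ◅ P₁ , P₂ , refl

  weight-cong : ∀ {ω ω′} → (∀ x y → ω x y ≡ ω′ x y) → ∀ {a b} (P : Star E a b) → weight ω P ≡ weight ω′ P
  weight-cong ω≗ω′ ε = refl
  weight-cong ω≗ω′ (_◅_ {a} {b} _ P) = cong₂ _xor_ (ω≗ω′ a b) (weight-cong ω≗ω′ P)

  weight-subst : ∀ ω {a b b′} (b≡b′ : b ≡ b′) (P : Star E a b) → weight ω (subst (Star E a) b≡b′ P) ≡ weight ω P
  weight-subst ω refl P = refl

  weight-◅◅ : ∀ ω {a b c} (P : Star E a b) (Q : Star E b c) → weight ω (P ◅◅ Q) ≡ weight ω P xor weight ω Q
  weight-◅◅ ω ε Q = refl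
  weight-◅◅ ω (_◅_ {a} {b} _ P) Q =
    trans (cong (ω a b xor_) (weight-◅◅ ω P Q)) (sym (xor-assoc (ω a b) _ _))

  weight-revApp : ∀ ω → SymmetricWeighting ω → (E-sym : ∀ {x y} → E x y → E y x) →
                  ∀ {a b c} (P : Star E b a) (Q : Star E b c) →
                  weight ω (revApp E-sym P Q) ≡ weight ω P xor weight ω Q
  weight-revApp ω ω-sym E-sym ε Q = refl
  weight-revApp ω ω-sym E-sym (_◅_ {b} {x} e P) Q = begin
    weight ω (revApp E-sym P (E-sym e ◅ Q))   ≡⟨ weight-revApp ω ω-sym E-sym P (E-sym e ◅ Q) ⟩
    weight ω P xor (ω x b xor weight ω Q) ≡⟨ cong (λ t → weight ω P xor (t xor weight ω Q)) (ω-sym x b) ⟩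
    weight ω P xor (ω b x xor weight ω Q) ≡⟨ sym (xor-assoc (weight ω P) _ _) ⟩
    (weight ω P xor ω b x) xor weight ω Q ≡⟨ cong (_xor weight ω Q) (xor-comm (weight ω P) _) ⟩
    (ω b x xor weight ω P) xor weight ω Q ∎
    where open ≡-Reasoning

  weight-reverse : ∀ ω → SymmetricWeighting ω → (E-sym : ∀ {x y} → E x y → E y x) →
                   ∀ {a b} (P : Star E a b) → weight ω (reverse E-sym P) ≡ weight ω P
  weight-reverse ω ω-sym E-sym P = trans (weight-revApp ω ω-sym E-sym P ε) (xor-identityʳ _)

  weight-gmap : ∀ ω (ρ : V → V) (f : ∀ {x y} → E x y → E (ρ x) (ρ y)) {a b} (P : Star E a b) →
                weight ω (gmap ρ f P) ≡ weight (λ x y → ω (ρ x) (ρ y)) P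
  weight-gmap ω ρ f ε = refl
  weight-gmap ω ρ f (_◅_ {a} {b} _ P) = cong (ω (ρ a) (ρ b) xor_) (weight-gmap ω ρ f P)

  weight-xor : ∀ ω ω′ {a b} (P : Star E a b) →
               weight ω P xor weight ω′ P ≡ weight (λ x y → ω x y xor ω′ x y) P
  weight-xor ω ω′ ε = refl
  weight-xor ω ω′ (_◅_ {a} {b} _ P) =
    trans (xor-interchange (ω a b) _ (ω′ a b) _) (cong ((ω a b xor ω′ a b) xor_) (weight-xor ω ω′ P))

  Simple : ∀ {a b} → Star E a b → Set
  Simple P = Unique (vertices P)

  Acyclic : Set
  Acyclic = ∀ {a} (C : Star E a a) → 3 ≤ length (starts C) → Unique (starts C) → ⊥

m+m≡n+n⇒m≡n : ∀ {m n} → m + m ≡ n + n → m ≡ n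
m+m≡n+n⇒m≡n {m} {n} eq with <-cmp m n
... | tri< m<n _ _ = ⊥-elim (<-irrefl eq (+-mono-< m<n m<n))
... | tri≈ _ m≡n _ = m≡n
... | tri> _ _ n<m = ⊥-elim (<-irrefl (sym eq) (+-mono-< n<m n<m))

xor≡false⇒≡ : ∀ x y → x xor y ≡ false → x ≡ y
xor≡false⇒≡ false false _ = refl
xor≡false⇒≡ true true _ = refl

Unique-++-∷ : ∀ {A : Set} (xs : List A) {y ys} → Unique (xs ++ y ∷ ys) → Unique (y ∷ xs) × Unique (y ∷ ys)
Unique-++-∷ [] u = ([] ∷ []) , u
Unique-++-∷ (x ∷ xs) (x∉ ∷ u) with Unique-++-∷ xs u
... | (y∉xs ∷ uxs) , uys = ((≢-sym x≢y ∷ y∉xs) ∷ (++⁻ˡ xs x∉ ∷ uxs)) , uys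
  where
  x≢y : x ≢ _
  x≢y = All.head (++⁻ʳ xs x∉)

module Balanced {V : Set} (_≟_ : DecidableEquality V) {E : Rel V 0ℓ}
                (E-irrefl : ∀ {a} → ¬ E a a) (acyclic : Acyclic {E = E}) where

  open import Data.List.Membership.DecPropositional _≟_ using (_∈?_)

  closing-weight : ∀ ω → SymmetricWeighting ω → ∀ {a b} (e : E a b) (P : Star E b a) →
                   Unique (a ∷ starts P) → weight ω (e ◅ P) ≡ false
  closing-weight ω ω-sym e ε _ = ⊥-elim (E-irrefl e)
  closing-weight ω ω-sym {a} {b} e (_ ◅ ε) _ = begin
    ω a b xor (ω b a xor false) ≡⟨ cong (ω a b xor_) (xor-identityʳ (ω b a)) ⟩
    ω a b xor ω b a             ≡⟨ cong (ω a b xor_) (ω-sym b a) ⟩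
    ω a b xor ω a b             ≡⟨ xor-same (ω a b) ⟩
    false                       ∎
    where open ≡-Reasoning
  closing-weight ω ω-sym e (e′ ◅ e″ ◅ P) u = ⊥-elim (acyclic (e ◅ e′ ◅ e″ ◅ P) (s≤s (s≤s (s≤s z≤n))) u)

  -- Cutting out the loop at a repeated vertex keeps the weight: the loop is a simple cycle, of length
  -- at most 2 in an acyclic graph.
  simplify : ∀ ω → SymmetricWeighting ω → ∀ {a b} (W : Star E a b) →
             Σ (Star E a b) λ P → Simple P × weight ω P ≡ weight ω W
  simplify ω ω-sym ε = ε , [] ∷ [] , refl
  simplify ω ω-sym (_◅_ {a} {b} e W) with simplify ω ω-sym W
  ... | P , simple , wP with a ∈? vertices P
  ...   | no a∉P = e ◅ P , ¬Any⇒All¬ (vertices P) a∉P ∷ simple , cong (ω a b xor_) wP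
  ...   | yes a∈P with split-at P a∈P
  ...     | P₁ , P₂ , refl = P₂ , simple₂ , weight₂
    where
    parts : Unique (a ∷ starts P₁) × Unique (vertices P₂)
    parts = Unique-++-∷ (starts P₁) (subst Unique (vertices-◅◅ P₁ P₂) simple)
    simple₂ : Simple P₂
    simple₂ = proj₂ parts
    open ≡-Reasoning
    weight₂ : weight ω P₂ ≡ ω a b xor weight ω W
    weight₂ = begin
      weight ω P₂                                   ≡⟨ cong (_xor weight ω P₂) (closing-weight ω ω-sym e P₁ (proj₁ parts)) ⟨
      weight ω (e ◅ P₁) xor weight ω P₂             ≡⟨ xor-assoc (ω a b) _ _ ⟩
      ω a b xor (weight ω P₁ xor weight ω P₂)       ≡⟨ cong (ω a b xor_) (weight-◅◅ ω P₁ P₂) ⟨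
      ω a b xor weight ω (P₁ ◅◅ P₂)                 ≡⟨ cong (ω a b xor_) wP ⟩
      ω a b xor weight ω W                          ∎

  closed-walk-weight : ∀ ω → SymmetricWeighting ω → ∀ {a} (W : Star E a a) → weight ω W ≡ false
  closed-walk-weight ω ω-sym W with simplify ω ω-sym W
  ... | ε , _ , wP = sym wP
  ... | e ◅ P , a∉ ∷ _ , _ = ⊥-elim (All.lookup a∉ (end∈targets e P) refl)

  module _ (E-sym : ∀ {x y} → E x y → E y x) where

    walk-weight-unique : ∀ ω → SymmetricWeighting ω → ∀ {a b} (P Q : Star E a b) → weight ω P ≡ weight ω Q
    walk-weight-unique ω ω-sym P Q = xor≡false⇒≡ _ _ (begin
      weight ω P xor weight ω Q                 ≡⟨ cong (_xor weight ω Q) (weight-reverse ω ω-sym E-sym P) ⟨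
      weight ω (reverse E-sym P) xor weight ω Q ≡⟨ weight-◅◅ ω (reverse E-sym P) Q ⟨
      weight ω (reverse E-sym P ◅◅ Q)           ≡⟨ closed-walk-weight ω ω-sym (reverse E-sym P ◅◅ Q) ⟩
      false                                     ∎)
      where open ≡-Reasoning

    module _ (ρ : V → V) (ρ-invol : ∀ a → ρ (ρ a) ≡ a) (E-ρ : ∀ {x y} → E x y → E (ρ x) (ρ y))
             (ω : Weighting V) (ω-sym : SymmetricWeighting ω)
             (ω-ρ : ∀ a b → ω (ρ a) (ρ b) ≡ ω a b) (ω-self : ∀ a → ω a (ρ a) ≡ false)
             (κ : V → ℕ) (κ-injective : ∀ a b → κ a ≡ κ b → a ≡ b) (N : ℕ) (κ-ρ : ∀ a → κ a + κ (ρ a) ≡ N) where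

      -- H keeps, of each pair of edges xy and ρx ρy, the one with the smaller κ-sum; hence ωH xor ωH∘ρ = ω
      -- (self-paired edges have ω-weight false), and the closed walk W ◅◅ ρ(W) has ωH-weight weight ω W.
      private
        H : Weighting V
        H x y = does (κ x + κ y <? κ (ρ x) + κ (ρ y))

        H-sym : SymmetricWeighting H
        H-sym x y rewrite +-comm (κ x) (κ y) | +-comm (κ (ρ x)) (κ (ρ y)) = refl

        H-self-paired : ∀ x y → H x y ≡ H (ρ x) (ρ y) → y ≡ ρ x
        H-self-paired x y eq = by-comparison (_ <? _) (_ <? _)
          (trans eq (cong₂ (λ u v → does (κ (ρ x) + κ (ρ y) <? κ u + κ v)) (ρ-invol x) (ρ-invol y)))
          where
          s s′ : ℕ
          s = κ x + κ y
          s′ = κ (ρ x) + κ (ρ y)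
          s≡N : s ≡ s′ → s ≡ N
          s≡N s≡s′ = m+m≡n+n⇒m≡n (begin
            s + s                                 ≡⟨ cong (s +_) s≡s′ ⟩
            (κ x + κ y) + (κ (ρ x) + κ (ρ y))     ≡⟨ +-interchange (κ x) (κ y) _ _ ⟩
            (κ x + κ (ρ x)) + (κ y + κ (ρ y))     ≡⟨ cong₂ _+_ (κ-ρ x) (κ-ρ y) ⟩
            N + N                                 ∎)
            where open ≡-Reasoning
          by-comparison : (d : Dec (s < s′)) (d′ : Dec (s′ < s)) → does d ≡ does d′ → y ≡ ρ x
          by-comparison (yes s<s′) (yes s′<s) _ = ⊥-elim (<-asym s<s′ s′<s)
          by-comparison (no s≮s′) (no s′≮s) _ =
            κ-injective y (ρ x) (+-cancelˡ-≡ (κ x) _ _ (trans (s≡N (≤-antisym (≮⇒≥ s′≮s) (≮⇒≥ s≮s′))) (sym (κ-ρ x))))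

        ωH : Weighting V
        ωH x y = ω x y ∧ H x y

        ωH-sym : SymmetricWeighting ωH
        ωH-sym x y = cong₂ _∧_ (ω-sym x y) (H-sym x y)

        ωH-self-paired : ∀ x y b → H x y ≡ H (ρ x) (ρ y) → (ω x y ∧ b) xor (ω x y ∧ b) ≡ ω x y
        ωH-self-paired x y b eq = trans (xor-same (ω x y ∧ b)) (sym (trans (cong (ω x) (H-self-paired x y eq)) (ω-self x)))

        ωH-split : ∀ x y → ωH x y xor ωH (ρ x) (ρ y) ≡ ω x y
        ωH-split x y rewrite ω-ρ x y with H x y in h | H (ρ x) (ρ y) in h′
        ... | true  | false = trans (cong₂ _xor_ (∧-identityʳ (ω x y)) (∧-zeroʳ (ω x y))) (xor-identityʳ (ω x y))
        ... | false | true  = trans (cong₂ _xor_ (∧-zeroʳ (ω x y)) (∧-identityʳ (ω x y))) (xor-identityˡ (ω x y))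
        ... | true  | true  = ωH-self-paired x y true (trans h (sym h′))
        ... | false | false = ωH-self-paired x y false (trans h (sym h′))

      mirror-walk-weight : ∀ {a} (W : Star E a (ρ a)) → weight ω W ≡ false
      mirror-walk-weight {a} W = begin
        weight ω W                                              ≡⟨ weight-cong ωH-split W ⟨
        weight (λ x y → ωH x y xor ωH (ρ x) (ρ y)) W            ≡⟨ weight-xor ωH _ W ⟨
        weight ωH W xor weight (λ x y → ωH (ρ x) (ρ y)) W       ≡⟨ cong (weight ωH W xor_) (weight-gmap ωH ρ E-ρ W) ⟨
        weight ωH W xor weight ωH (gmap ρ E-ρ W)                ≡⟨ weight-◅◅ ωH W (gmap ρ E-ρ W) ⟨
        weight ωH (W ◅◅ gmap ρ E-ρ W)                           ≡⟨ weight-subst ωH (ρ-invol a) _ ⟨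
        weight ωH closed                                        ≡⟨ closed-walk-weight ωH ωH-sym closed ⟩
        false                                                   ∎
        where
        open ≡-Reasoning
        closed : Star E a a
        closed = subst (Star E a) (ρ-invol a) (W ◅◅ gmap ρ E-ρ W)

module _ {A : Set} {P : Pred A 0ℓ} where

  find-sound : (P? : Decidable P) (xs : List A) {a : A} → find P? xs ≡ just a → P a
  find-sound P? (x ∷ xs) eq with P? x
  find-sound P? (x ∷ xs) refl | yes p = p
  ... | no _ = find-sound P? xs eq

  find-complete : (P? : Decidable P) {xs : List A} {a : A} → a ∈ xs → P a → ∃ λ b → find P? xs ≡ just b
  find-complete P? {x ∷ xs} a∈xs pa with P? x
  ... | yes _ = x , refl
  find-complete P? (here refl) pa | no ¬pa = ⊥-elim (¬pa pa)
  find-complete P? (there a∈xs) pa | no _ = find-complete P? a∈xs pa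

module _ {A : Set} {P Q : Pred A 0ℓ} where

  find-cong : (P? : Decidable P) (Q? : Decidable Q) → (∀ {x} → P x → Q x) → (∀ {x} → Q x → P x) →
              ∀ xs → find P? xs ≡ find Q? xs
  find-cong P? Q? P⇒Q Q⇒P [] = refl
  find-cong P? Q? P⇒Q Q⇒P (x ∷ xs) with P? x | Q? x
  ... | yes _ | yes _ = refl
  ... | yes p | no ¬q = ⊥-elim (¬q (P⇒Q p))
  ... | no ¬p | yes q = ⊥-elim (¬p (Q⇒P q))
  ... | no _  | no _  = find-cong P? Q? P⇒Q Q⇒P xs

module Potential {V : Set} {E : Rel V 0ℓ} (E-sym : ∀ {x y} → E x y → E y x)
                 (ρ : V → V) (ρ-invol : ∀ a → ρ (ρ a) ≡ a) (E-ρ : ∀ {x y} → E x y → E (ρ x) (ρ y))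
                 (ω : Weighting V) (ω-sym : SymmetricWeighting ω) (ω-ρ : ∀ a b → ω (ρ a) (ρ b) ≡ ω a b)
                 (weight-unique : ∀ {a b} (P Q : Star E a b) → weight ω P ≡ weight ω Q)
                 (mirror-weight : ∀ {a} (W : Star E a (ρ a)) → weight ω W ≡ false)
                 (vs : List V) (vs-complete : ∀ v → v ∈ vs)
                 (reach? : ∀ a b → Dec (Star E a b)) where

  open ≡-Reasoning

  Reaches : V → V → Set
  Reaches a b = Star E a b ⊎ Star E a (ρ b)

  reaches? : ∀ a b → Dec (Reaches a b)
  reaches? a b = reach? a b ⊎-dec reach? a (ρ b)

  reach-weight : ∀ {a b} → Reaches a b → Bool
  reach-weight (inj₁ W) = weight ω W
  reach-weight (inj₂ W) = weight ω W

  cross-weight : ∀ {a b} (P : Star E a b) (Q : Star E a (ρ b)) → weight ω P ≡ weight ω Q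
  cross-weight P Q = xor≡false⇒≡ _ _ (begin
    weight ω P xor weight ω Q                 ≡⟨ cong (_xor weight ω Q) (weight-reverse ω ω-sym E-sym P) ⟨
    weight ω (reverse E-sym P) xor weight ω Q ≡⟨ weight-◅◅ ω (reverse E-sym P) Q ⟨
    weight ω (reverse E-sym P ◅◅ Q)           ≡⟨ mirror-weight (reverse E-sym P ◅◅ Q) ⟩
    false                                     ∎)

  reach-weight-unique : ∀ {a b} (R R′ : Reaches a b) → reach-weight R ≡ reach-weight R′
  reach-weight-unique (inj₁ P) (inj₁ Q) = weight-unique P Q
  reach-weight-unique (inj₁ P) (inj₂ Q) = cross-weight P Q
  reach-weight-unique (inj₂ P) (inj₁ Q) = sym (cross-weight Q P)
  reach-weight-unique (inj₂ P) (inj₂ Q) = weight-unique P Q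

  -- Rooting b at the first vertex that reaches b or ρ b makes the root, hence the potential, ρ-invariant.
  root : V → Maybe V
  root b = find (λ a → reaches? a b) vs

  rooted : ∀ b → Σ V λ a → root b ≡ just a × Reaches a b
  rooted b with find-complete (λ a → reaches? a b) (vs-complete b) (inj₁ ε)
  ... | a , eq = a , eq , find-sound (λ a → reaches? a b) vs eq

  potentialFrom : ∀ {a b} → Dec (Reaches a b) → Bool
  potentialFrom (yes R) = reach-weight R
  potentialFrom (no _) = false

  potential : V → Bool
  potential b = maybe (λ a → potentialFrom (reaches? a b)) false (root b)

  potential-via : ∀ {a b} → root b ≡ just a → (R : Reaches a b) → potential b ≡ reach-weight R
  potential-via {a} {b} eq R rewrite eq with reaches? a b
  ... | yes R′ = reach-weight-unique R′ R
  ... | no ¬R = ⊥-elim (¬R R)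

  potential-transfer : ∀ {b b′} δ (f : ∀ {a} → Reaches a b → Reaches a b′) → (∀ {a} → Reaches a b′ → Reaches a b) →
                       (∀ {a} (R : Reaches a b) → reach-weight (f R) ≡ reach-weight R xor δ) →
                       potential b′ ≡ potential b xor δ
  potential-transfer {b} {b′} δ f g f-weight with rooted b
  ... | a , eq , R = begin
    potential b′          ≡⟨ potential-via (trans (find-cong _ _ g f vs) eq) (f R) ⟩
    reach-weight (f R)    ≡⟨ f-weight R ⟩
    reach-weight R xor δ  ≡⟨ cong (_xor δ) (potential-via eq R) ⟨
    potential b xor δ     ∎

  potential-edge : ∀ {u v} → E u v → potential v ≡ potential u xor ω u v
  potential-edge {u} {v} e = potential-transfer (ω u v) forward backward forward-weight
    where
    forward : ∀ {a} → Reaches a u → Reaches a v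
    forward (inj₁ W) = inj₁ (W ◅◅ e ◅ ε)
    forward (inj₂ W) = inj₂ (W ◅◅ E-ρ e ◅ ε)
    backward : ∀ {a} → Reaches a v → Reaches a u
    backward (inj₁ W) = inj₁ (W ◅◅ E-sym e ◅ ε)
    backward (inj₂ W) = inj₂ (W ◅◅ E-sym (E-ρ e) ◅ ε)
    forward-weight : ∀ {a} (R : Reaches a u) → reach-weight (forward R) ≡ reach-weight R xor ω u v
    forward-weight (inj₁ W) = trans (weight-◅◅ ω W (e ◅ ε)) (cong (weight ω W xor_) (xor-identityʳ (ω u v)))
    forward-weight (inj₂ W) =
      trans (weight-◅◅ ω W (E-ρ e ◅ ε)) (cong (weight ω W xor_) (trans (xor-identityʳ _) (ω-ρ u v)))

  potential-ρ : ∀ b → potential (ρ b) ≡ potential b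
  potential-ρ b = trans (potential-transfer false swap unswap swap-weight) (xor-identityʳ (potential b))
    where
    swap : ∀ {a} → Reaches a b → Reaches a (ρ b)
    swap (inj₁ W) = inj₂ (subst (Star E _) (sym (ρ-invol b)) W)
    swap (inj₂ W) = inj₁ W
    unswap : ∀ {a} → Reaches a (ρ b) → Reaches a b
    unswap (inj₁ W) = inj₂ W
    unswap (inj₂ W) = inj₁ (subst (Star E _) (ρ-invol b) W)
    swap-weight : ∀ {a} (R : Reaches a b) → reach-weight (swap R) ≡ reach-weight R xor false
    swap-weight (inj₁ W) = trans (weight-subst ω (sym (ρ-invol b)) W) (sym (xor-identityʳ _))
    swap-weight (inj₂ W) = sym (xor-identityʳ _)

StrictlyBetween-sym : ∀ {a b k} → StrictlyBetween a b k → StrictlyBetween b a k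
StrictlyBetween-sym (inj₁ p) = inj₂ p
StrictlyBetween-sym (inj₂ p) = inj₁ p

StrictlyBetween-opposite : ∀ {n} {a b k : Fin n} → StrictlyBetween (toℕ (opposite a)) (toℕ (opposite b)) (toℕ k) →
                           StrictlyBetween (toℕ a) (toℕ b) (toℕ (opposite k))
StrictlyBetween-opposite (inj₁ (a<k , k<b)) = inj₂ (opposite-<ʳ k<b , opposite-<ˡ a<k)
StrictlyBetween-opposite (inj₂ (b<k , k<a)) = inj₁ (opposite-<ʳ k<a , opposite-<ˡ b<k)

sign : Entry → Bool
sign neg = true
sign _ = false

isZero? : (e : Entry) → Dec (e ≡ zer)
isZero? zer = yes refl
isZero? pos = no λ ()
isZero? neg = no λ ()

rotate : ∀ {r c} → Cell r c → Cell r c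
rotate (i , j) = opposite i , opposite j

rotate-involutive : ∀ {r c} (a : Cell r c) → rotate (rotate a) ≡ a
rotate-involutive (i , j) = cong₂ _,_ (opposite-involutive i) (opposite-involutive j)

cells : ∀ r c → List (Cell r c)
cells r c = cartesianProduct (allFin r) (allFin c)

∈-cells : ∀ {r c} (a : Cell r c) → a ∈ cells r c
∈-cells (i , j) = ∈-cartesianProduct⁺ (∈-allFin i) (∈-allFin j)

cellIndex : ∀ {r c} → Cell r c → ℕ
cellIndex (i , j) = toℕ (combine i j)

cellIndex-injective : ∀ {r c} (a b : Cell r c) → cellIndex a ≡ cellIndex b → a ≡ b
cellIndex-injective (i , j) (i′ , j′) eq with combine-injective i j i′ j′ (toℕ-injective eq)
... | refl , refl = refl

cellIndex-+-rotate : ∀ {r c} (a : Cell r c) → cellIndex a + cellIndex (rotate a) ≡ c * pred r + pred c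
cellIndex-+-rotate {r} {c} (i , j) = begin
  toℕ (combine i j) + toℕ (combine (opposite i) (opposite j))
    ≡⟨ cong₂ _+_ (toℕ-combine i j) (toℕ-combine (opposite i) (opposite j)) ⟩
  (c * toℕ i + toℕ j) + (c * toℕ (opposite i) + toℕ (opposite j))
    ≡⟨ regroup c (toℕ i) (toℕ (opposite i)) (toℕ j) (toℕ (opposite j)) ⟩
  c * (toℕ i + toℕ (opposite i)) + (toℕ j + toℕ (opposite j))
    ≡⟨ cong₂ (λ x y → c * x + y) (cong pred (suc-toℕ-+-opposite i)) (cong pred (suc-toℕ-+-opposite j)) ⟩
  c * pred r + pred c ∎
  where
  open ≡-Reasoning
  regroup : ∀ c x y u v → (c * x + u) + (c * y + v) ≡ c * (x + y) + (u + v)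
  regroup = solve-∀

module LineSupport {m : ℕ} {Z : Fin m → Set} (Z? : ∀ k → Dec (Z k)) (g : Fin m → Bool)
  (step : ∀ {k k′} → ¬ Z k → ¬ Z k′ → toℕ k < toℕ k′ →
          (∀ l → toℕ k < toℕ l → toℕ l < toℕ k′ → Z l) → g k ≡ g k′) where

  private
    Gap : Fin m → ℕ → Set
    Gap l n = ∀ x → toℕ l < toℕ x → toℕ x < n → Z x

    last-support : ∀ {k} → ¬ Z k → ∀ n → toℕ k < n → n ≤ m → ∃ λ l → ¬ Z l × g k ≡ g l × toℕ l < n × Gap l n
    last-support {k} k∉Z (suc n) k<1+n 1+n≤m with toℕ k ≟ℕ n
    ... | yes refl = k , k∉Z , refl , k<1+n , λ x k<x x<1+n → ⊥-elim (<-irrefl refl (<-≤-trans k<x (≤-pred x<1+n)))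
    ... | no k≢n with last-support k∉Z n (≤∧≢⇒< (≤-pred k<1+n) k≢n) (<⇒≤ 1+n≤m)
    ...   | l , l∉Z , gk≡gl , l<n , gap with Z? (fromℕ< 1+n≤m)
    ...     | yes n∈Z = l , l∉Z , gk≡gl , m<n⇒m<1+n l<n , gap′
      where
      gap′ : Gap l (suc n)
      gap′ x l<x x<1+n with m≤n⇒m<n∨m≡n (≤-pred x<1+n)
      ... | inj₁ x<n = gap x l<x x<n
      ... | inj₂ x≡n = subst Z (toℕ-injective (trans (toℕ-fromℕ< 1+n≤m) (sym x≡n))) n∈Z
    ...     | no n∉Z = fromℕ< 1+n≤m , n∉Z , trans gk≡gl (step l∉Z n∉Z l<n′ gap′) , n′<1+n , empty
      where
      l<n′ : toℕ l < toℕ (fromℕ< 1+n≤m)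
      l<n′ = subst (toℕ l <_) (sym (toℕ-fromℕ< 1+n≤m)) l<n
      gap′ : ∀ x → toℕ l < toℕ x → toℕ x < toℕ (fromℕ< 1+n≤m) → Z x
      gap′ x l<x x<n = gap x l<x (subst (toℕ x <_) (toℕ-fromℕ< 1+n≤m) x<n)
      n′<1+n : toℕ (fromℕ< 1+n≤m) < suc n
      n′<1+n = subst (_< suc n) (sym (toℕ-fromℕ< 1+n≤m)) (n<1+n n)
      empty : Gap (fromℕ< 1+n≤m) (suc n)
      empty x n<x x<1+n = ⊥-elim (<-irrefl refl (<-≤-trans (subst (_< toℕ x) (toℕ-fromℕ< 1+n≤m) n<x) (≤-pred x<1+n)))

    forward : ∀ {k k′} → ¬ Z k → ¬ Z k′ → toℕ k < toℕ k′ → g k ≡ g k′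
    forward {k} {k′} k∉Z k′∉Z k<k′ with last-support k∉Z (toℕ k′) k<k′ (<⇒≤ (toℕ<n k′))
    ... | l , l∉Z , gk≡gl , l<k′ , gap = trans gk≡gl (step l∉Z k′∉Z l<k′ gap)

  support-constant : ∀ {k k′} → ¬ Z k → ¬ Z k′ → g k ≡ g k′
  support-constant {k} {k′} k∉Z k′∉Z with <-cmp (toℕ k) (toℕ k′)
  ... | tri< k<k′ _ _ = forward k∉Z k′∉Z k<k′
  ... | tri≈ _ k≡k′ _ = cong g (toℕ-injective k≡k′)
  ... | tri> _ _ k′<k = sym (forward k′∉Z k∉Z k′<k)

support-value : ∀ {m} {S : Fin m → Set} (S? : ∀ k → Dec (S k)) (g : Fin m → Bool) →
                (∀ {k k′} → S k → S k′ → g k ≡ g k′) →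
                ∀ {k} → S k → does (any? (λ k → S? k ×-dec (g k ≟ᴮ true))) ≡ g k
support-value S? g constant {k} k∈S with g k in gk
... | true = dec-true (any? (λ k → S? k ×-dec (g k ≟ᴮ true))) (k , k∈S , gk)
... | false = dec-false (any? (λ k → S? k ×-dec (g k ≟ᴮ true)))
                λ (k′ , k′∈S , gk′) → true≢false (trans (sym gk′) (trans (constant k′∈S k∈S) gk))
  where
  true≢false : true ≢ false
  true≢false ()

HalvesFit : Entry → Bool → Bool → Set
HalvesFit zer _ _ = ⊤
HalvesFit pos row column = row ≡ column
HalvesFit neg row column = row ≡ not column

-- column j (row i) tells which half of column j (row i) receives the points of π: the right (upper)
-- one if true.  The half-turn image of π uses the other halves.
record IsHalving {r c} (A : Matrix r c) (column : Fin c → Bool) (row : Fin r → Bool) : Set where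
  field
    fits : ∀ i j → HalvesFit (A i j) (row i) (column j)
    column-opposite : ∀ j → column (opposite j) ≡ column j
    row-opposite : ∀ i → row (opposite i) ≡ row i

module CellGraph {r c : ℕ} (A : Matrix r c) where

  entry≢zer : ∀ {i j e} → A i j ≡ e → e ≢ zer → NonZeroCell A (i , j)
  entry≢zer Aij≡e e≢zer Aij≡zer = e≢zer (trans (sym Aij≡e) Aij≡zer)

  nonZero? : ∀ a → Dec (NonZeroCell A a)
  nonZero? (i , j) = ¬? (isZero? (A i j))

  CellEdge : Rel (Cell r c) 0ℓ
  CellEdge u v = NonZeroCell A u × Adjacent A u v × NonZeroCell A v

  CellEdge-irrefl : ∀ {a} → ¬ CellEdge a a
  CellEdge-irrefl (_ , inj₁ (_ , j≢j , _) , _) = j≢j refl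
  CellEdge-irrefl (_ , inj₂ (_ , i≢i , _) , _) = i≢i refl

  CellEdge-sym : ∀ {a b} → CellEdge a b → CellEdge b a
  CellEdge-sym (u≢0 , inj₁ (refl , j≢j′ , between) , v≢0) =
    v≢0 , inj₁ (refl , j≢j′ ∘ sym , λ k → between k ∘ StrictlyBetween-sym) , u≢0
  CellEdge-sym (u≢0 , inj₂ (refl , i≢i′ , between) , v≢0) =
    v≢0 , inj₂ (refl , i≢i′ ∘ sym , λ k → between k ∘ StrictlyBetween-sym) , u≢0

  forest⇒acyclic : CellGraphIsForest A → Acyclic {E = CellEdge}
  forest⇒acyclic forest ε () _
  forest⇒acyclic forest (_◅_ {a} e P) 3≤ unique =
    forest (a ∷ starts P , 3≤ , unique , nonZeros (e ◅ P) , closing (proj₁ (proj₂ e)) P)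
    where
    nonZeros : ∀ {x y} (W : Star CellEdge x y) → All (NonZeroCell A) (starts W)
    nonZeros ε = []
    nonZeros (e ◅ W) = proj₁ e ∷ nonZeros W
    closing : ∀ {u x y} → Adjacent A u x → (W : Star CellEdge x y) → PathFrom A y (starts W) u
    closing adj ε = adj
    closing adj (e ◅ W) = adj , closing (proj₁ (proj₂ e)) W

  -- The potential of a non-zero cell will be the half chosen for its column: it is constant along
  -- columns and, along a row, flips exactly where the sign of the entry does.
  rowSignChange : Weighting (Cell r c)
  rowSignChange (i , j) (i′ , j′) = if does (i ≟ i′) then sign (A i j) xor sign (A i′ j′) else false

  rowSignChange-sym : SymmetricWeighting rowSignChange
  rowSignChange-sym (i , j) (i′ , j′) with i ≟ i′ | i′ ≟ i
  ... | yes _ | yes _ = xor-comm (sign (A i j)) _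
  ... | yes refl | no i≢i = ⊥-elim (i≢i refl)
  ... | no i≢i | yes refl = ⊥-elim (i≢i refl)
  ... | no _ | no _ = refl

  rowSignChange-column : ∀ {i i′ j} → i ≢ i′ → rowSignChange (i , j) (i′ , j) ≡ false
  rowSignChange-column {i} {i′} i≢i′ with i ≟ i′
  ... | yes i≡i′ = ⊥-elim (i≢i′ i≡i′)
  ... | no _ = refl

  rowSignChange-row : ∀ {i j j′} → rowSignChange (i , j) (i , j′) ≡ sign (A i j) xor sign (A i j′)
  rowSignChange-row {i} with i ≟ i
  ... | yes _ = refl
  ... | no i≢i = ⊥-elim (i≢i refl)

  module Rotation (cs : Centrosymmetric A) where

    entry-rotate : ∀ i j → A (opposite i) j ≡ A i (opposite j)
    entry-rotate i j = trans (cs (opposite i) j) (cong (λ x → A x (opposite j)) (opposite-involutive i))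

    NonZero-rotate : ∀ {a} → NonZeroCell A a → NonZeroCell A (rotate a)
    NonZero-rotate {i , j} a≢0 eq = a≢0 (trans (cs i j) eq)

    CellEdge-rotate : ∀ {a b} → CellEdge a b → CellEdge (rotate a) (rotate b)
    CellEdge-rotate {i , j} (u≢0 , inj₁ (refl , j≢j′ , between) , v≢0) =
      NonZero-rotate u≢0 ,
      inj₁ (refl , j≢j′ ∘ opposite-injective , λ k sb → trans (entry-rotate i k) (between (opposite k) (StrictlyBetween-opposite sb))) ,
      NonZero-rotate v≢0
    CellEdge-rotate {i , j} (u≢0 , inj₂ (refl , i≢i′ , between) , v≢0) =
      NonZero-rotate u≢0 ,
      inj₂ (refl , i≢i′ ∘ opposite-injective , λ k sb → trans (sym (entry-rotate k j)) (between (opposite k) (StrictlyBetween-opposite sb))) ,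
      NonZero-rotate v≢0

    sign-rotate : ∀ a → sign (A (opposite (proj₁ a)) (opposite (proj₂ a))) ≡ sign (A (proj₁ a) (proj₂ a))
    sign-rotate (i , j) = cong sign (sym (cs i j))

    rowSignChange-rotate : ∀ a b → rowSignChange (rotate a) (rotate b) ≡ rowSignChange a b
    rowSignChange-rotate (i , j) (i′ , j′) with opposite i ≟ opposite i′ | i ≟ i′
    ... | yes _ | yes _ = cong₂ _xor_ (sign-rotate (i , j)) (sign-rotate (i′ , j′))
    ... | yes eq | no i≢i′ = ⊥-elim (i≢i′ (opposite-injective eq))
    ... | no oi≢oi′ | yes refl = ⊥-elim (oi≢oi′ refl)
    ... | no _ | no _ = refl

    rowSignChange-self : ∀ a → rowSignChange a (rotate a) ≡ false
    rowSignChange-self (i , j) with i ≟ opposite i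
    ... | yes _ = trans (cong (sign (A i j) xor_) (sign-rotate (i , j))) (xor-same (sign (A i j)))
    ... | no _ = refl

    module Potentials (forest : CellGraphIsForest A) (reach? : ∀ a b → Dec (Star CellEdge a b)) where

      open Balanced (×-≡-dec _≟_ _≟_) CellEdge-irrefl (forest⇒acyclic forest)
      open Potential CellEdge-sym rotate rotate-involutive CellEdge-rotate
                     rowSignChange rowSignChange-sym rowSignChange-rotate
                     (walk-weight-unique CellEdge-sym rowSignChange rowSignChange-sym)
                     (mirror-walk-weight CellEdge-sym rotate rotate-involutive CellEdge-rotate
                        rowSignChange rowSignChange-sym rowSignChange-rotate rowSignChange-self
                        cellIndex cellIndex-injective _ cellIndex-+-rotate)
                     (cells r c) ∈-cells reach?
        public

      gap-between : ∀ {m} {Z : Fin m → Set} {k k′ : Fin m} → toℕ k < toℕ k′ →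
                    (∀ l → toℕ k < toℕ l → toℕ l < toℕ k′ → Z l) →
                    ∀ l → StrictlyBetween (toℕ k) (toℕ k′) (toℕ l) → Z l
      gap-between k<k′ gap l (inj₁ (k<l , l<k′)) = gap l k<l l<k′
      gap-between k<k′ gap l (inj₂ (k′<l , l<k)) = ⊥-elim (<-asym k<k′ (<-trans k′<l l<k))

      column-constant : ∀ j {i i′} → NonZeroCell A (i , j) → NonZeroCell A (i′ , j) → potential (i , j) ≡ potential (i′ , j)
      column-constant j = LineSupport.support-constant (λ i → isZero? (A i j)) (λ i → potential (i , j)) step
        where
        step : ∀ {k k′} → ¬ A k j ≡ zer → ¬ A k′ j ≡ zer → toℕ k < toℕ k′ →
               (∀ l → toℕ k < toℕ l → toℕ l < toℕ k′ → A l j ≡ zer) → potential (k , j) ≡ potential (k′ , j)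
        step {k} {k′} k≢0 k′≢0 k<k′ gap = sym (begin
          potential (k′ , j)                                        ≡⟨ potential-edge edge ⟩
          potential (k , j) xor rowSignChange (k , j) (k′ , j)      ≡⟨ cong (potential (k , j) xor_) (rowSignChange-column k≢k′) ⟩
          potential (k , j) xor false                               ≡⟨ xor-identityʳ _ ⟩
          potential (k , j)                                         ∎)
          where
          open ≡-Reasoning
          k≢k′ : k ≢ k′
          k≢k′ refl = <-irrefl refl k<k′
          edge : CellEdge (k , j) (k′ , j)
          edge = k≢0 , inj₂ (refl , k≢k′ , gap-between k<k′ gap) , k′≢0

      rowPotential : Cell r c → Bool
      rowPotential (i , j) = potential (i , j) xor sign (A i j)

      row-constant : ∀ i {j j′} → NonZeroCell A (i , j) → NonZeroCell A (i , j′) → rowPotential (i , j) ≡ rowPotential (i , j′)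
      row-constant i = LineSupport.support-constant (λ j → isZero? (A i j)) (λ j → rowPotential (i , j)) step
        where
        step : ∀ {k k′} → ¬ A i k ≡ zer → ¬ A i k′ ≡ zer → toℕ k < toℕ k′ →
               (∀ l → toℕ k < toℕ l → toℕ l < toℕ k′ → A i l ≡ zer) → rowPotential (i , k) ≡ rowPotential (i , k′)
        step {k} {k′} k≢0 k′≢0 k<k′ gap = sym (begin
          potential (i , k′) xor s′                         ≡⟨ cong (_xor s′) (potential-edge edge) ⟩
          (potential (i , k) xor rowSignChange (i , k) (i , k′)) xor s′ ≡⟨ cong (λ x → (potential (i , k) xor x) xor s′) rowSignChange-row ⟩
          (potential (i , k) xor (s xor s′)) xor s′         ≡⟨ xor-assoc (potential (i , k)) _ _ ⟩
          potential (i , k) xor ((s xor s′) xor s′)         ≡⟨ cong (potential (i , k) xor_) (xor-assoc s s′ s′) ⟩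
          potential (i , k) xor (s xor (s′ xor s′))         ≡⟨ cong (λ x → potential (i , k) xor (s xor x)) (xor-same s′) ⟩
          potential (i , k) xor (s xor false)               ≡⟨ cong (potential (i , k) xor_) (xor-identityʳ s) ⟩
          potential (i , k) xor s                           ∎)
          where
          open ≡-Reasoning
          s s′ : Bool
          s = sign (A i k)
          s′ = sign (A i k′)
          k≢k′ : k ≢ k′
          k≢k′ refl = <-irrefl refl k<k′
          edge : CellEdge (i , k) (i , k′)
          edge = k≢0 , inj₁ (refl , k≢k′ , gap-between k<k′ gap) , k′≢0

      Marked : (Cell r c → Bool) → Cell r c → Set
      Marked f a = NonZeroCell A a × f a ≡ true

      marked? : ∀ f a → Dec (Marked f a)
      marked? f a = nonZero? a ×-dec (f a ≟ᴮ true)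

      Marked-rotate : ∀ {f} → (∀ a → f (rotate a) ≡ f a) → ∀ {a} → Marked f a → Marked f (rotate a)
      Marked-rotate f-rotate {a} (a≢0 , fa) = NonZero-rotate a≢0 , trans (f-rotate a) fa

      rowPotential-rotate : ∀ a → rowPotential (rotate a) ≡ rowPotential a
      rowPotential-rotate a = cong₂ _xor_ (potential-ρ a) (sign-rotate a)

      column : Fin c → Bool
      column j = does (any? λ i → marked? potential (i , j))

      row : Fin r → Bool
      row i = does (any? λ j → marked? rowPotential (i , j))

      column-value : ∀ {i j} → NonZeroCell A (i , j) → column j ≡ potential (i , j)
      column-value {i} {j} = support-value (λ i → nonZero? (i , j)) (λ i → potential (i , j)) (column-constant j)

      row-value : ∀ {i j} → NonZeroCell A (i , j) → row i ≡ rowPotential (i , j)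
      row-value {i} {j} = support-value (λ j → nonZero? (i , j)) (λ j → rowPotential (i , j)) (row-constant i)

      column-opposite : ∀ j → column (opposite j) ≡ column j
      column-opposite j = does-⇔ (mk⇔ to from) (any? _) (any? _)
        where
        to : ∃ (λ i → Marked potential (i , opposite j)) → ∃ (λ i → Marked potential (i , j))
        to (i , m) = opposite i , subst (λ x → Marked potential (opposite i , x)) (opposite-involutive j) (Marked-rotate potential-ρ m)
        from : ∃ (λ i → Marked potential (i , j)) → ∃ (λ i → Marked potential (i , opposite j))
        from (i , m) = opposite i , Marked-rotate potential-ρ m

      row-opposite : ∀ i → row (opposite i) ≡ row i
      row-opposite i = does-⇔ (mk⇔ to from) (any? _) (any? _)
        where
        to : ∃ (λ j → Marked rowPotential (opposite i , j)) → ∃ (λ j → Marked rowPotential (i , j))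
        to (j , m) = opposite j , subst (λ x → Marked rowPotential (x , opposite j)) (opposite-involutive i) (Marked-rotate rowPotential-rotate m)
        from : ∃ (λ j → Marked rowPotential (i , j)) → ∃ (λ j → Marked rowPotential (opposite i , j))
        from (j , m) = opposite j , Marked-rotate rowPotential-rotate m

      fits : ∀ i j → HalvesFit (A i j) (row i) (column j)
      fits i j with A i j in eq
      ... | zer = tt
      ... | pos = begin
        row i                               ≡⟨ row-value (entry≢zer eq λ ()) ⟩
        potential (i , j) xor sign (A i j)  ≡⟨ cong (λ e → potential (i , j) xor sign e) eq ⟩
        potential (i , j) xor false         ≡⟨ xor-identityʳ _ ⟩
        potential (i , j)                   ≡⟨ column-value (entry≢zer eq λ ()) ⟨
        column j                            ∎
        where open ≡-Reasoning
      ... | neg = begin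
        row i                               ≡⟨ row-value (entry≢zer eq λ ()) ⟩
        potential (i , j) xor sign (A i j)  ≡⟨ cong (λ e → potential (i , j) xor sign e) eq ⟩
        potential (i , j) xor true          ≡⟨ xor-comm _ true ⟩
        true xor potential (i , j)          ≡⟨ true-xor _ ⟩
        not (potential (i , j))             ≡⟨ cong not (column-value (entry≢zer eq λ ())) ⟨
        not (column j)                      ∎
        where open ≡-Reasoning

      isHalving : IsHalving A column row
      isHalving = record { fits = fits ; column-opposite = column-opposite ; row-opposite = row-opposite }

∃-vector? : ∀ {X : Set} (xs : List X) → (∀ x → x ∈ xs) → ∀ n {P : Vec X n → Set} → (∀ v → Dec (P v)) → Dec (∃ P)
∃-vector? xs complete n P? = map′ satisfied (λ (v , p) → lose (∈-vectors complete v) p) (anyᴸ? P? (vectors xs n))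

∈-bools : ∀ b → b ∈ true ∷ false ∷ []
∈-bools true = here refl
∈-bools false = there (here refl)

¬¬-All : ∀ {X : Set} {P : X → Set} (xs : List X) → (∀ x → ¬ ¬ P x) → ¬ ¬ All P xs
¬¬-All [] _ k = k []
¬¬-All (x ∷ xs) h k = h x λ px → ¬¬-All xs h λ pxs → k (px ∷ pxs)

¬¬-∀ : ∀ {X : Set} {P : X → Set} (xs : List X) → (∀ x → x ∈ xs) → (∀ x → ¬ ¬ P x) → ¬ ¬ (∀ x → P x)
¬¬-∀ xs complete h = ¬¬-map (λ all x → All.lookup all (complete x)) (¬¬-All xs h)

fits? : ∀ e row column → Dec (HalvesFit e row column)
fits? zer _ _ = yes tt
fits? pos row column = row ≟ᴮ column
fits? neg row column = row ≟ᴮ not column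

module _ {r c : ℕ} (A : Matrix r c) where

  isHalving? : ∀ column row → Dec (IsHalving A column row)
  isHalving? column row =
    map′ (λ (f , co , ro) → record { fits = f ; column-opposite = co ; row-opposite = ro })
         (λ h → IsHalving.fits h , IsHalving.column-opposite h , IsHalving.row-opposite h)
         (all? (λ i → all? λ j → fits? (A i j) (row i) (column j)) ×-dec
          all? (λ j → column (opposite j) ≟ᴮ column j) ×-dec
          all? (λ i → row (opposite i) ≟ᴮ row i))

  IsHalving-cong : ∀ {column column′ row row′} → (∀ j → column j ≡ column′ j) → (∀ i → row i ≡ row′ i) →
                   IsHalving A column row → IsHalving A column′ row′
  IsHalving-cong {column} {column′} {row} {row′} col≗ row≗ h = record
    { fits = λ i j → subst₂ (HalvesFit (A i j)) (row≗ i) (col≗ j) (IsHalving.fits h i j)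
    ; column-opposite = λ j → trans (sym (col≗ (opposite j))) (trans (IsHalving.column-opposite h j) (col≗ j))
    ; row-opposite = λ i → trans (sym (row≗ (opposite i))) (trans (IsHalving.row-opposite h i) (row≗ i))
    }

  -- Reachability in the cell graph is decidable only classically, but the existence of a halving is
  -- decidable by finite search, so the double negation can be removed.
  halving : Centrosymmetric A → CellGraphIsForest A → ∃ λ column → ∃ λ row → IsHalving A column row
  halving cs forest with decidable-stable search (¬¬-map fromPotentials ¬¬reach?)
    where
    open CellGraph A
    search : Dec (∃ λ (t : Vec Bool c) → ∃ λ (u : Vec Bool r) → IsHalving A (lookup t) (lookup u))
    search = ∃-vector? _ ∈-bools c λ t → ∃-vector? _ ∈-bools r λ u → isHalving? (lookup t) (lookup u)
    ¬¬reach? : ¬ ¬ (∀ a b → Dec (Star CellEdge a b))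
    ¬¬reach? = ¬¬-∀ (cells r c) ∈-cells λ a → ¬¬-∀ (cells r c) ∈-cells λ b → ¬¬-excluded-middle
    fromPotentials : (∀ a b → Dec (Star CellEdge a b)) → ∃ λ (t : Vec Bool c) → ∃ λ (u : Vec Bool r) → IsHalving A (lookup t) (lookup u)
    fromPotentials reach? = tabulate column , tabulate row ,
      IsHalving-cong (sym ∘ lookup∘tabulate column) (sym ∘ lookup∘tabulate row) isHalving
      where open Rotation.Potentials cs forest reach?
  ... | t , u , h = lookup t , lookup u , h

count : ∀ {M} {P : Pred (Fin M) 0ℓ} → Decidable P → ℕ
count {zero} P? = 0
count {suc M} P? with P? zero
... | yes _ = suc (count (P? ∘ suc))
... | no _ = count (P? ∘ suc)

count-mono : ∀ {M} {P Q : Pred (Fin M) 0ℓ} (P? : Decidable P) (Q? : Decidable Q) →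
             (∀ {k} → P k → Q k) → count P? ≤ count Q?
count-mono {zero} P? Q? P⇒Q = z≤n
count-mono {suc M} P? Q? P⇒Q with P? zero | Q? zero
... | yes _ | yes _ = s≤s (count-mono (P? ∘ suc) (Q? ∘ suc) P⇒Q)
... | yes p | no ¬q = ⊥-elim (¬q (P⇒Q p))
... | no _  | yes _ = m≤n⇒m≤1+n (count-mono (P? ∘ suc) (Q? ∘ suc) P⇒Q)
... | no _  | no _  = count-mono (P? ∘ suc) (Q? ∘ suc) P⇒Q

count-mono-< : ∀ {M} {P Q : Pred (Fin M) 0ℓ} (P? : Decidable P) (Q? : Decidable Q) →
               (∀ {k} → P k → Q k) → ∀ k → ¬ P k → Q k → count P? < count Q?
count-mono-< P? Q? P⇒Q zero ¬p q with P? zero | Q? zero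
... | yes p | _     = ⊥-elim (¬p p)
... | no _  | yes _ = s≤s (count-mono (P? ∘ suc) (Q? ∘ suc) P⇒Q)
... | no _  | no ¬q = ⊥-elim (¬q q)
count-mono-< P? Q? P⇒Q (suc k) ¬p q with P? zero | Q? zero
... | yes _ | yes _ = s≤s (count-mono-< (P? ∘ suc) (Q? ∘ suc) P⇒Q k ¬p q)
... | yes p | no ¬q = ⊥-elim (¬q (P⇒Q p))
... | no _  | yes _ = m≤n⇒m≤1+n (count-mono-< (P? ∘ suc) (Q? ∘ suc) P⇒Q k ¬p q)
... | no _  | no _  = count-mono-< (P? ∘ suc) (Q? ∘ suc) P⇒Q k ¬p q

count-cong : ∀ {M} {P Q : Pred (Fin M) 0ℓ} (P? : Decidable P) (Q? : Decidable Q) →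
             (∀ {k} → P k → Q k) → (∀ {k} → Q k → P k) → count P? ≡ count Q?
count-cong P? Q? P⇒Q Q⇒P = ≤-antisym (count-mono P? Q? P⇒Q) (count-mono Q? P? Q⇒P)

count≤ : ∀ {M} {P : Pred (Fin M) 0ℓ} (P? : Decidable P) → count P? ≤ M
count≤ {zero} P? = z≤n
count≤ {suc M} P? with P? zero
... | yes _ = s≤s (count≤ (P? ∘ suc))
... | no _ = m≤n⇒m≤1+n (count≤ (P? ∘ suc))

count-< : ∀ {M} {P : Pred (Fin M) 0ℓ} (P? : Decidable P) → ∀ k → ¬ P k → count P? < M
count-< {suc M} P? zero ¬p with P? zero
... | yes p = ⊥-elim (¬p p)
... | no _ = s≤s (count≤ (P? ∘ suc))
count-< {suc M} P? (suc k) ¬p with P? zero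
... | yes _ = s≤s (count-< (P? ∘ suc) k ¬p)
... | no _ = m≤n⇒m≤1+n (count-< (P? ∘ suc) k ¬p)

count-none : ∀ {M} {P : Pred (Fin M) 0ℓ} (P? : Decidable P) → (∀ k → ¬ P k) → count P? ≡ 0
count-none {zero} P? ¬P = refl
count-none {suc M} P? ¬P with P? zero
... | yes p = ⊥-elim (¬P zero p)
... | no _ = count-none (P? ∘ suc) (¬P ∘ suc)

count-split : ∀ m {n} {P : Pred (Fin (m + n)) 0ℓ} (P? : Decidable P) →
              count P? ≡ count (P? ∘ (_↑ˡ n)) + count (P? ∘ (m ↑ʳ_))
count-split zero P? = refl
count-split (suc m) P? with P? zero
... | yes _ = cong suc (count-split m (P? ∘ suc))
... | no _ = count-split m (P? ∘ suc)

count-prefix : ∀ {M} (k : Fin M) → count {M} (λ l → toℕ l <? toℕ k) ≡ toℕ k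
count-prefix {suc M} zero = count-none {suc M} (λ l → toℕ l <? 0) λ _ ()
count-prefix {suc M} (suc k) = cong suc (trans
  (count-cong {M} (λ l → suc (toℕ l) <? suc (toℕ k)) (λ l → toℕ l <? toℕ k) ≤-pred s≤s) (count-prefix k))


DownwardClosed : ∀ {M} → Pred (Fin M) 0ℓ → Set
DownwardClosed P = ∀ {k l} → toℕ l ≤ toℕ k → P k → P l

initial-count⁺ : ∀ {M} {P : Pred (Fin M) 0ℓ} (P? : Decidable P) → DownwardClosed P →
                 ∀ {k} → P k → toℕ k < count P?
initial-count⁺ P? closed {zero} p with P? zero
... | yes _ = s≤s z≤n
... | no ¬p = ⊥-elim (¬p p)
initial-count⁺ P? closed {suc k} p with P? zero
... | yes _ = s≤s (initial-count⁺ (P? ∘ suc) (closed ∘ s≤s) p)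
... | no ¬p = ⊥-elim (¬p (closed z≤n p))

initial-count⁻ : ∀ {M} {P : Pred (Fin M) 0ℓ} (P? : Decidable P) → DownwardClosed P →
                 ∀ {k} → toℕ k < count P? → P k
initial-count⁻ {suc M} P? closed {k} k<count with P? zero
initial-count⁻ {suc M} P? closed {zero} k<count | yes p = p
initial-count⁻ {suc M} P? closed {suc k} k<count | yes _ = initial-count⁻ (P? ∘ suc) (closed ∘ s≤s) (≤-pred k<count)
... | no ¬p₀ = ⊥-elim (n≮0 (subst (toℕ k <_) (count-none (P? ∘ suc) λ l p → ¬p₀ (closed z≤n p)) k<count))

injective⇒surjective : ∀ {M} (f : Fin M → Fin M) → Injective _≡_ _≡_ f → ∀ p → ∃ λ e → f e ≡ p
injective⇒surjective {suc M} f f-injective p with any? (λ e → f e ≟ p)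
... | yes found = found
... | no missed = ⊥-elim (1+n≰n (injective⇒≤ g-injective))
  where
  g : Fin (suc M) → Fin M
  g e = punchOut {i = p} {j = f e} λ eq → missed (e , sym eq)
  g-injective : Injective _≡_ _≡_ g
  g-injective {a} {b} eq = f-injective (punchOut-injective (λ eq → missed (a , sym eq)) (λ eq → missed (b , sym eq)) eq)

module Inverse {M : ℕ} (f : Fin M → Fin M) (f-injective : Injective _≡_ _≡_ f) where

  f⁻¹ : Fin M → Fin M
  f⁻¹ p = proj₁ (injective⇒surjective f f-injective p)

  inverseʳ : ∀ p → f (f⁻¹ p) ≡ p
  inverseʳ p = proj₂ (injective⇒surjective f f-injective p)

  inverseˡ : ∀ e → f⁻¹ (f e) ≡ e
  inverseˡ e = f-injective (inverseʳ (f e))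

  f⁻¹-injective : Injective _≡_ _≡_ f⁻¹
  f⁻¹-injective {a} {b} eq = trans (sym (inverseʳ a)) (trans (cong f eq) (inverseʳ b))

StrictlyIncreasing : ∀ {n} → (Fin n → Fin n) → Set
StrictlyIncreasing h = ∀ {a b} → toℕ a < toℕ b → toℕ (h a) < toℕ (h b)

increasing⇒≥ : ∀ {n} (h : Fin n → Fin n) → StrictlyIncreasing h → ∀ k → toℕ k ≤ toℕ (h k)
increasing⇒≥ {n} h increasing k = bound (toℕ k) k refl
  where
  bound : ∀ t k → toℕ k ≡ t → t ≤ toℕ (h k)
  bound zero k _ = z≤n
  bound (suc t) k k≡1+t = ≤-<-trans (bound t k′ (toℕ-fromℕ< t<n)) (increasing k′<k)
    where
    t<k : t < toℕ k
    t<k = subst (t <_) (sym k≡1+t) (n<1+n t)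
    t<n : t < n
    t<n = <-trans t<k (toℕ<n k)
    k′ : Fin n
    k′ = fromℕ< t<n
    k′<k : toℕ k′ < toℕ k
    k′<k = subst (_< toℕ k) (sym (toℕ-fromℕ< t<n)) t<k

increasing⇒id : ∀ {n} (h : Fin n → Fin n) → StrictlyIncreasing h → ∀ k → h k ≡ k
increasing⇒id h increasing k = toℕ-injective (≤-antisym (≮⇒≥ below) (increasing⇒≥ h increasing k))
  where
  mirrored : StrictlyIncreasing (opposite ∘ h ∘ opposite)
  mirrored lt = opposite-reverses-< (increasing (opposite-reverses-< lt))
  below : ¬ toℕ k < toℕ (h k)
  below k<hk = <-irrefl refl (<-≤-trans (opposite-reverses-< k<hk)
    (subst (λ x → toℕ (opposite k) ≤ toℕ (opposite (h x))) (opposite-involutive k)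
      (increasing⇒≥ (opposite ∘ h ∘ opposite) mirrored (opposite k))))

same-order : ∀ {n} (f g : Fin n → Fin n) → Injective _≡_ _≡_ g →
             (∀ {a b} → toℕ (g a) < toℕ (g b) → toℕ (f a) < toℕ (f b)) → ∀ k → f k ≡ g k
same-order f g g-injective ordered k = trans (cong f (sym (inverseˡ k))) (increasing⇒id (f ∘ f⁻¹) increasing (g k))
  where
  open Inverse g g-injective
  increasing : StrictlyIncreasing (f ∘ f⁻¹)
  increasing {a} {b} lt = ordered (subst₂ (λ x y → toℕ x < toℕ y) (sym (inverseʳ a)) (sym (inverseʳ b)) lt)

mono⇒reflects : ∀ {X : Set} (g h : X → ℕ) → (∀ {a b} → g a ≡ g b → a ≡ b) →
                (∀ {a b} → g a < g b → h a < h b) → ∀ {a b} → h a < h b → g a < g b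
mono⇒reflects g h g-injective mono {a} {b} lt with <-cmp (g a) (g b)
... | tri< ga<gb _ _ = ga<gb
... | tri≈ _ ga≡gb _ = ⊥-elim (<-irrefl (cong h (g-injective ga≡gb)) lt)
... | tri> _ _ gb<ga = ⊥-elim (<-asym lt (mono gb<ga))

module Ranking {M : ℕ} (Z : Fin M → ℕ) (Z-injective : Injective _≡_ _≡_ Z) where

  below? : ∀ e → Decidable (λ e′ → Z e′ < Z e)
  below? e e′ = Z e′ <? Z e

  rank : Fin M → Fin M
  rank e = fromℕ< (count-< (below? e) e (<-irrefl refl))

  toℕ-rank : ∀ e → toℕ (rank e) ≡ count (below? e)
  toℕ-rank e = toℕ-fromℕ< _

  rank-mono : ∀ {a b} → Z a < Z b → toℕ (rank a) < toℕ (rank b)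
  rank-mono {a} {b} Za<Zb rewrite toℕ-rank a | toℕ-rank b =
    count-mono-< (below? a) (below? b) (λ lt → <-trans lt Za<Zb) a (<-irrefl refl) Za<Zb

  rank-reflects : ∀ {a b} → toℕ (rank a) < toℕ (rank b) → Z a < Z b
  rank-reflects = mono⇒reflects Z (toℕ ∘ rank) Z-injective rank-mono

  rank-injective : Injective _≡_ _≡_ rank
  rank-injective {a} {b} eq with <-cmp (Z a) (Z b)
  ... | tri< p _ _ = ⊥-elim (<-irrefl (cong toℕ eq) (rank-mono p))
  ... | tri≈ _ p _ = Z-injective p
  ... | tri> _ _ p = ⊥-elim (<-irrefl (cong toℕ (sym eq)) (rank-mono p))

  rank-opposite : (∀ {a b} → Z a < Z b → Z (opposite b) < Z (opposite a)) → ∀ e → rank (opposite e) ≡ opposite (rank e)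
  rank-opposite reverses e = trans (sym (opposite-involutive _)) (cong opposite (same-order mirrored rank rank-injective ordered e))
    where
    mirrored : Fin M → Fin M
    mirrored = opposite ∘ rank ∘ opposite
    ordered : ∀ {a b} → toℕ (rank a) < toℕ (rank b) → toℕ (mirrored a) < toℕ (mirrored b)
    ordered lt = opposite-reverses-< (rank-mono (reverses (rank-reflects lt)))

+-reverses-< : ∀ {p a q b} → p + a ≡ q + b → a < b → q < p
+-reverses-< {p} {a} {q} {b} eq a<b with <-cmp q p
... | tri< q<p _ _ = q<p
... | tri≈ _ refl _ = ⊥-elim (<-irrefl (+-cancelˡ-≡ q a b eq) a<b)
... | tri> _ _ p<q = ⊥-elim (<-irrefl eq (+-mono-< p<q a<b))

module Flatten {M : ℕ} (X Y : Fin M → ℕ) (X-injective : Injective _≡_ _≡_ X) (Y-injective : Injective _≡_ _≡_ Y) where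

  module RX = Ranking X X-injective
  module RY = Ranking Y Y-injective
  open Inverse RX.rank RX.rank-injective renaming (f⁻¹ to byX)

  flatten : Perm M
  flatten = tabulate (RY.rank ∘ byX)

  lookup-flatten : ∀ p → lookup flatten p ≡ RY.rank (byX p)
  lookup-flatten = lookup∘tabulate (RY.rank ∘ byX)

  flatten-at-rank : ∀ e → lookup flatten (RX.rank e) ≡ RY.rank e
  flatten-at-rank e = trans (lookup-flatten (RX.rank e)) (cong RY.rank (inverseˡ e))

  flatten-isPerm : IsPerm flatten
  flatten-isPerm p q eq = f⁻¹-injective (RY.rank-injective (trans (sym (lookup-flatten p)) (trans eq (lookup-flatten q))))

  flatten-inGeom : ∀ {r c} (A : Matrix r c) m → (∀ e → OnFigure A (suc m) (X e) (Y e)) → InGeom A flatten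
  flatten-inGeom A m onFigure = flatten-isPerm , m , X ∘ byX , Y ∘ byX , increasing , ordered , onFigure ∘ byX
    where
    increasing : ∀ p q → toℕ p < toℕ q → X (byX p) < X (byX q)
    increasing p q lt = RX.rank-reflects (subst₂ (λ u v → toℕ u < toℕ v) (sym (inverseʳ p)) (sym (inverseʳ q)) lt)
    ordered : ∀ p q → (Y (byX p) < Y (byX q)) ⇔ (toℕ (lookup flatten p) < toℕ (lookup flatten q))
    ordered p q rewrite lookup-flatten p | lookup-flatten q = mk⇔ RY.rank-mono RY.rank-reflects

  flatten-centrosymmetric : ∀ {SX SY} → (∀ e → X (opposite e) + X e ≡ SX) → (∀ e → Y (opposite e) + Y e ≡ SY) →
                            IsCentrosymmetricPerm flatten
  flatten-centrosymmetric X-sum Y-sum p = begin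
    lookup flatten p                                ≡⟨ lookup-flatten p ⟩
    RY.rank (byX p)                                 ≡⟨ opposite-involutive _ ⟨
    opposite (opposite (RY.rank (byX p)))           ≡⟨ cong opposite (RY.rank-opposite (reverses {Y} Y-sum) (byX p)) ⟨
    opposite (RY.rank (opposite (byX p)))           ≡⟨ cong (opposite ∘ RY.rank) byX-opposite ⟨
    opposite (RY.rank (byX (opposite p)))           ≡⟨ cong opposite (lookup-flatten (opposite p)) ⟨
    opposite (lookup flatten (opposite p))          ∎
    where
    open ≡-Reasoning
    reverses : ∀ {Z : Fin M → ℕ} {S} → (∀ e → Z (opposite e) + Z e ≡ S) → ∀ {a b} → Z a < Z b → Z (opposite b) < Z (opposite a)
    reverses sum {a} {b} = +-reverses-< (trans (sum a) (sym (sum b)))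
    byX-opposite : byX (opposite p) ≡ opposite (byX p)
    byX-opposite = RX.rank-injective (trans (inverseʳ (opposite p))
      (sym (trans (RX.rank-opposite (reverses {X} X-sum) (byX p)) (cong opposite (inverseʳ p)))))

Monotone : ∀ {n c} → (Fin n → Fin c) → Set
Monotone f = ∀ {k l} → toℕ k ≤ toℕ l → toℕ (f k) ≤ toℕ (f l)

profile : ∀ {n c} → (Fin n → Fin c) → Vec (Fin (suc n)) c
profile f = tabulate λ j → fromℕ< (s≤s (count≤ (λ k → toℕ (f k) ≤? toℕ j)))

toℕ-profile : ∀ {n c} (f : Fin n → Fin c) j → toℕ (lookup (profile f) j) ≡ count (λ k → toℕ (f k) ≤? toℕ j)
toℕ-profile f j = trans (cong toℕ (lookup∘tabulate _ j)) (toℕ-fromℕ< _)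

profile-injective : ∀ {n c} {f g : Fin n → Fin c} → Monotone f → Monotone g → profile f ≡ profile g → ∀ k → f k ≡ g k
profile-injective {f = f} {g} f-mono g-mono same-profile k =
  toℕ-injective (≤-antisym (≤-from-profile g f g-mono f-mono (sym ∘ same-count) k) (≤-from-profile f g f-mono g-mono same-count k))
  where
  same-count : ∀ j → count (λ k → toℕ (f k) ≤? toℕ j) ≡ count (λ k → toℕ (g k) ≤? toℕ j)
  same-count j = trans (sym (toℕ-profile f j)) (trans (cong (λ v → toℕ (lookup v j)) same-profile) (toℕ-profile g j))
  ≤-from-profile : ∀ f g → Monotone f → Monotone g → (∀ j → count (λ k → toℕ (f k) ≤? toℕ j) ≡ count (λ k → toℕ (g k) ≤? toℕ j)) →
                   ∀ k → toℕ (g k) ≤ toℕ (f k)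
  ≤-from-profile f g f-mono g-mono counts k =
    initial-count⁻ (λ l → toℕ (g l) ≤? toℕ (f k)) (λ l≤k gk≤ → ≤-trans (g-mono l≤k) gk≤)
      (subst (toℕ k <_) (counts (f k)) (initial-count⁺ (λ l → toℕ (f l) ≤? toℕ (f k)) (λ l≤k fk≤ → ≤-trans (f-mono l≤k) fk≤) ≤-refl))

OnDiagonal : Entry → ℕ → ℕ → ℕ → Set
OnDiagonal zer N t u = ⊥
OnDiagonal pos N t u = u ≡ t
OnDiagonal neg N t u = t + u ≡ N

-- Row 0 is the top row: cell (i , j) has its lower-left corner at (toℕ j * N , toℕ (opposite i) * N).
record LocalPoint {r c} (A : Matrix r c) (N : ℕ) : Set where
  constructor localPoint
  field
    i : Fin r
    j : Fin c
    dx dy : ℕ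
    dx≤N : dx ≤ N
    dy≤N : dy ≤ N
    on-diagonal : OnDiagonal (A i j) N dx dy

  x : ℕ
  x = toℕ j * N + dx

  y : ℕ
  y = toℕ (opposite i) * N + dy

module _ {r c} {A : Matrix r c} {N : ℕ} where

  local⇒onFigure : (p : LocalPoint A N) → OnFigure A N (LocalPoint.x p) (LocalPoint.y p)
  local⇒onFigure (localPoint i j dx dy dx≤N dy≤N diagonal) rewrite opposite-prop i =
    i , j , m≤m+n x₀ dx , +-monoʳ-≤ x₀ dx≤N , m≤m+n y₀ dy , +-monoʳ-≤ y₀ dy≤N , on-cell-diagonal (A i j) diagonal
    where
    x₀ y₀ : ℕ
    x₀ = toℕ j * N
    y₀ = (r ∸ suc (toℕ i)) * N
    on-cell-diagonal : ∀ e → OnDiagonal e N dx dy →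
      (e ≡ pos × (y₀ + dy) + x₀ ≡ (x₀ + dx) + y₀) ⊎ (e ≡ neg × (x₀ + dx) + (y₀ + dy) ≡ x₀ + N + y₀)
    on-cell-diagonal pos refl = inj₁ (refl , swap y₀ dy x₀)
      where
      swap : ∀ a b c → (a + b) + c ≡ (c + b) + a
      swap = solve-∀
    on-cell-diagonal neg dx+dy≡N = inj₂ (refl , trans (regroup x₀ dx y₀ dy) (cong (λ s → x₀ + s + y₀) dx+dy≡N))
      where
      regroup : ∀ a b c d → (a + b) + (c + d) ≡ a + (b + d) + c
      regroup = solve-∀

  onFigure⇒local : ∀ {x y} → OnFigure A N x y → Σ (LocalPoint A N) λ p → x ≡ LocalPoint.x p × y ≡ LocalPoint.y p
  onFigure⇒local {x} {y} (i , j , x₀≤x , x≤x₀+N , y₀≤y , y≤y₀+N , diagonal) =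
    localPoint i j dx dy (m≤n+o⇒m∸n≤o x x₀ x≤x₀+N) (m≤n+o⇒m∸n≤o y y₀ y≤y₀+N) (on-diagonal diagonal) ,
    sym (m+[n∸m]≡n x₀≤x) , trans (sym (m+[n∸m]≡n y₀≤y)) (cong (λ z → z * N + dy) (sym (opposite-prop i)))
    where
    x₀ y₀ dx dy : ℕ
    x₀ = toℕ j * N
    y₀ = (r ∸ suc (toℕ i)) * N
    dx = x ∸ x₀
    dy = y ∸ y₀
    x≡ : x ≡ x₀ + dx
    x≡ = sym (m+[n∸m]≡n x₀≤x)
    y≡ : y ≡ y₀ + dy
    y≡ = sym (m+[n∸m]≡n y₀≤y)
    on-diagonal : (A i j ≡ pos × y + x₀ ≡ x + y₀) ⊎ (A i j ≡ neg × x + y ≡ x₀ + N + y₀) → OnDiagonal (A i j) N dx dy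
    on-diagonal (inj₁ (eq , slope)) rewrite eq = +-cancelˡ-≡ (x₀ + y₀) dy dx (begin
      x₀ + y₀ + dy     ≡⟨ regroup₁ x₀ y₀ dy ⟩
      (y₀ + dy) + x₀   ≡⟨ cong (_+ x₀) y≡ ⟨
      y + x₀           ≡⟨ slope ⟩
      x + y₀           ≡⟨ cong (_+ y₀) x≡ ⟩
      (x₀ + dx) + y₀   ≡⟨ regroup₂ x₀ dx y₀ ⟩
      x₀ + y₀ + dx     ∎)
      where
      open ≡-Reasoning
      regroup₁ : ∀ a b d → a + b + d ≡ (b + d) + a
      regroup₁ = solve-∀
      regroup₂ : ∀ a d b → (a + d) + b ≡ a + b + d
      regroup₂ = solve-∀
    on-diagonal (inj₂ (eq , slope)) rewrite eq = +-cancelˡ-≡ (x₀ + y₀) (dx + dy) N (begin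
      x₀ + y₀ + (dx + dy)         ≡⟨ regroup₁ x₀ y₀ dx dy ⟩
      (x₀ + dx) + (y₀ + dy)       ≡⟨ cong₂ _+_ x≡ y≡ ⟨
      x + y                       ≡⟨ slope ⟩
      x₀ + N + y₀                 ≡⟨ regroup₂ x₀ N y₀ ⟩
      x₀ + y₀ + N                 ∎)
      where
      open ≡-Reasoning
      regroup₁ : ∀ a b d e → a + b + (d + e) ≡ (a + d) + (b + e)
      regroup₁ = solve-∀
      regroup₂ : ∀ a n b → a + n + b ≡ a + b + n
      regroup₂ = solve-∀

-- Each cell is refined to width 2N + 4: the left half carries the offsets 1 … N + 1 and the right half
-- N + 3 … 2N + 3, so that points in different halves or cells never share a coordinate.
module Halves (N : ℕ) where

  width : ℕ
  width = suc (N + N + 3)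

  half : Bool → ℕ → ℕ
  half false t = suc t
  half true t = N + 3 + t

  half≤ : ∀ b t → half b t ≤ N + 3 + t
  half≤ false t = ≤-trans (m≤n+m (suc t) (N + 2)) (≤-reflexive (shuffle N t))
    where
    shuffle : ∀ N t → N + 2 + suc t ≡ N + 3 + t
    shuffle = solve-∀
  half≤ true t = ≤-refl

  half<width : ∀ b {t} → t ≤ N → half b t < width
  half<width b {t} t≤N = ≤-trans (s≤s (≤-trans (half≤ b t) (+-monoʳ-≤ (N + 3) t≤N))) (≤-reflexive (cong suc (shuffle N)))
    where
    shuffle : ∀ N → N + 3 + N ≡ N + N + 3
    shuffle = solve-∀

  half-mono : ∀ b {t t′} → t < t′ → half b t < half b t′
  half-mono false t<t′ = s≤s t<t′
  half-mono true t<t′ = +-monoʳ-< _ t<t′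

  half-separated : ∀ {t} t′ → t ≤ N → half false t < half true t′
  half-separated {t} t′ t≤N = ≤-trans (s≤s (s≤s t≤N)) (≤-trans (m≤n+m (suc (suc N)) 1) (≤-trans (≤-reflexive (shuffle N)) (m≤m+n (N + 3) t′)))
    where
    shuffle : ∀ N → 1 + suc (suc N) ≡ N + 3
    shuffle = solve-∀

  half-complement : ∀ b {t} → t ≤ N → half b t + half (not b) (N ∸ t) ≡ width
  half-complement false {t} t≤N = trans (shuffle N t (N ∸ t)) (cong (λ s → suc (N + s + 3)) (m+[n∸m]≡n t≤N))
    where
    shuffle : ∀ N t s → suc t + (N + 3 + s) ≡ suc (N + (t + s) + 3)
    shuffle = solve-∀
  half-complement true {t} t≤N = trans (shuffle N t (N ∸ t)) (cong (λ s → suc (N + s + 3)) (m+[n∸m]≡n t≤N))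
    where
    shuffle : ∀ N t s → N + 3 + t + suc s ≡ suc (N + (t + s) + 3)
    shuffle = solve-∀

  half-injective : ∀ {b b′ t t′} → t ≤ N → t′ ≤ N → half b t ≡ half b′ t′ → b ≡ b′ × t ≡ t′
  half-injective {false} {false} _ _ eq = refl , suc-injective eq
  half-injective {true} {true} _ _ eq = refl , +-cancelˡ-≡ (N + 3) _ _ eq
  half-injective {false} {true} {t′ = t′} t≤N _ eq = ⊥-elim (<-irrefl eq (half-separated t′ t≤N))
  half-injective {true} {false} {t = t} _ t′≤N eq = ⊥-elim (<-irrefl (sym eq) (half-separated t t′≤N))

  half-flipped-< : ∀ b {s t} → t ≤ N → half (not b) s < half b t → b ≡ true
  half-flipped-< true _ _ = refl
  half-flipped-< false {s} t≤N lt = ⊥-elim (<-asym lt (half-separated s t≤N))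

  coord : ℕ → Bool → ℕ → ℕ
  coord a b t = a * width + half b t

  coord-<-cell : ∀ {a a′} b b′ {t} t′ → a < a′ → t ≤ N → coord a b t < coord a′ b′ t′
  coord-<-cell {a} {a′} b b′ {t} t′ a<a′ t≤N = begin-strict
    a * width + half b t     <⟨ +-monoʳ-< (a * width) (half<width b t≤N) ⟩
    a * width + width        ≡⟨ +-comm (a * width) width ⟩
    suc a * width            ≤⟨ *-monoˡ-≤ width a<a′ ⟩
    a′ * width               ≤⟨ m≤m+n (a′ * width) (half b′ t′) ⟩
    a′ * width + half b′ t′  ∎
    where open ≤-Reasoning

  coord-< : ∀ {a a′ b b′ t t′} → t ≤ N → t′ ≤ N → coord a b t < coord a′ b′ t′ →
            a < a′ ⊎ (a ≡ a′ × half b t < half b′ t′)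
  coord-< {a} {a′} {b} {b′} {t} {t′} t≤N t′≤N lt with <-cmp a a′
  ... | tri< a<a′ _ _ = inj₁ a<a′
  ... | tri≈ _ refl _ = inj₂ (refl , +-cancelˡ-< (a * width) _ _ lt)
  ... | tri> _ _ a′<a = ⊥-elim (<-asym lt (coord-<-cell b′ b t a′<a t′≤N))

  coord-injective : ∀ {a a′ b b′ t t′} → t ≤ N → t′ ≤ N → coord a b t ≡ coord a′ b′ t′ → a ≡ a′ × b ≡ b′ × t ≡ t′
  coord-injective {a} {a′} {b} {b′} {t} {t′} t≤N t′≤N eq with <-cmp a a′
  ... | tri< a<a′ _ _ = ⊥-elim (<-irrefl eq (coord-<-cell b b′ t′ a<a′ t≤N))
  ... | tri≈ _ refl _ = refl , half-injective t≤N t′≤N (+-cancelˡ-≡ (a * width) _ _ eq)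
  ... | tri> _ _ a′<a = ⊥-elim (<-irrefl (sym eq) (coord-<-cell b′ b t a′<a t′≤N))

scaled-< : ∀ {N a a′ t t′} → t′ ≤ N → a * N + t < a′ * N + t′ → a < a′ ⊎ (a ≡ a′ × t < t′)
scaled-< {N} {a} {a′} {t} {t′} t′≤N lt with <-cmp a a′
... | tri< a<a′ _ _ = inj₁ a<a′
... | tri≈ _ refl _ = inj₂ (refl , +-cancelˡ-< (a * N) _ _ lt)
... | tri> _ _ a′<a = ⊥-elim (<-irrefl refl (<-≤-trans lt (begin
    a′ * N + t′   ≤⟨ +-monoʳ-≤ (a′ * N) t′≤N ⟩
    a′ * N + N    ≡⟨ +-comm (a′ * N) N ⟩
    suc a′ * N    ≤⟨ *-monoˡ-≤ N a′<a ⟩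
    a * N         ≤⟨ m≤m+n (a * N) t ⟩
    a * N + t     ∎)))
  where open ≤-Reasoning

-- The mirrored copy of a point in column j′ lies left of an original point in column j.
MirrorLeft : ∀ {c} → (Fin c → Bool) → Fin c → Fin c → Set
MirrorLeft column j′ j = toℕ (opposite j′) < toℕ j ⊎ (opposite j′ ≡ j × column j ≡ true)

module Placement {r c} {A : Matrix r c} (cs : Centrosymmetric A) {column : Fin c → Bool} {row : Fin r → Bool}
                (halving : IsHalving A column row) (N : ℕ) where

  open Halves N public
  open IsHalving halving

  private
    double-diagonal : ∀ e {rb cb dx dy} → dx ≤ N → HalvesFit e rb cb → OnDiagonal e N dx dy →
                      OnDiagonal e width (half cb dx) (half rb dy)
    double-diagonal pos _ refl refl = refl
    double-diagonal neg {cb = cb} {dx} {dy} dx≤N refl dx+dy≡N =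
      trans (cong (λ s → half cb dx + half (not cb) s) dy≡N∸dx) (half-complement cb dx≤N)
      where
      dy≡N∸dx : dy ≡ N ∸ dx
      dy≡N∸dx = trans (sym (m+n∸m≡n dx dy)) (cong (_∸ dx) dx+dy≡N)

    mirror-diagonal : ∀ e {rb cb dx dy} → dx ≤ N → HalvesFit e rb cb → OnDiagonal e N dx dy →
                      OnDiagonal e width (half (not cb) (N ∸ dx)) (half (not rb) (N ∸ dy))
    mirror-diagonal pos _ refl refl = refl
    mirror-diagonal neg {cb = cb} {dx} {dy} dx≤N refl dx+dy≡N = begin
      half (not cb) (N ∸ dx) + half (not (not cb)) (N ∸ dy) ≡⟨ cong₂ (λ b s → half (not cb) (N ∸ dx) + half b s) (not-involutive cb) N∸dy≡dx ⟩
      half (not cb) (N ∸ dx) + half cb dx                   ≡⟨ +-comm (half (not cb) (N ∸ dx)) (half cb dx) ⟩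
      half cb dx + half (not cb) (N ∸ dx)                   ≡⟨ half-complement cb dx≤N ⟩
      width                                                 ∎
      where
      open ≡-Reasoning
      N∸dy≡dx : N ∸ dy ≡ dx
      N∸dy≡dx = trans (cong (_∸ dy) (sym dx+dy≡N)) (m+n∸n≡m dx dy)

  double : LocalPoint A N → LocalPoint A width
  double (localPoint i j dx dy dx≤N dy≤N diagonal) =
    localPoint i j (half (column j) dx) (half (row i) dy) (<⇒≤ (half<width (column j) dx≤N)) (<⇒≤ (half<width (row i) dy≤N))
               (double-diagonal (A i j) dx≤N (fits i j) diagonal)

  mirror : LocalPoint A N → LocalPoint A width
  mirror (localPoint i j dx dy dx≤N dy≤N diagonal) =
    localPoint (opposite i) (opposite j) (half (not (column j)) (N ∸ dx)) (half (not (row i)) (N ∸ dy))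
               (<⇒≤ (half<width (not (column j)) (m∸n≤m N dx))) (<⇒≤ (half<width (not (row i)) (m∸n≤m N dy)))
               (subst (λ e → OnDiagonal e width _ _) (cs i j) (mirror-diagonal (A i j) dx≤N (fits i j) diagonal))

  open LocalPoint

  mirror-cell-sum : ∀ {n} (k : Fin n) b {t} → t ≤ N → coord (toℕ (opposite k)) (not b) (N ∸ t) + coord (toℕ k) b t ≡ n * width
  mirror-cell-sum {n} k b {t} t≤N = begin
    (toℕ (opposite k) * width + half (not b) (N ∸ t)) + (toℕ k * width + half b t)
      ≡⟨ shuffle (toℕ k) (toℕ (opposite k)) width (half b t) (half (not b) (N ∸ t)) ⟩
    (toℕ k + toℕ (opposite k)) * width + (half b t + half (not b) (N ∸ t))
      ≡⟨ cong ((toℕ k + toℕ (opposite k)) * width +_) (half-complement b t≤N) ⟩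
    (toℕ k + toℕ (opposite k)) * width + width
      ≡⟨ +-comm ((toℕ k + toℕ (opposite k)) * width) width ⟩
    suc (toℕ k + toℕ (opposite k)) * width
      ≡⟨ cong (_* width) (suc-toℕ-+-opposite k) ⟩
    n * width ∎
    where
    open ≡-Reasoning
    shuffle : ∀ k o w h h′ → (o * w + h′) + (k * w + h) ≡ (k + o) * w + (h + h′)
    shuffle = solve-∀

  mirror-x-sum : ∀ p → x (mirror p) + x (double p) ≡ c * width
  mirror-x-sum (localPoint i j dx dy dx≤N dy≤N _) = mirror-cell-sum j (column j) dx≤N

  mirror-y-sum : ∀ p → y (mirror p) + y (double p) ≡ r * width
  mirror-y-sum (localPoint i j dx dy dx≤N dy≤N _) = mirror-cell-sum (opposite i) (row i) dy≤N

  private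
    coord-mono : ∀ {X : Set} {n} (key : X → Fin n) → (∀ {a b} → key a ≡ key b → a ≡ b) → (side : X → Bool) →
                 ∀ {a a′ t t′} → t ≤ N → t′ ≤ N → toℕ (key a) * N + t < toℕ (key a′) * N + t′ →
                 coord (toℕ (key a)) (side a) t < coord (toℕ (key a′)) (side a′) t′
    coord-mono key key-injective side {a} {a′} t≤N t′≤N lt with scaled-< t′≤N lt
    ... | inj₁ a<a′ = coord-<-cell (side a) (side a′) _ a<a′ t≤N
    ... | inj₂ (a≡a′ , t<t′) with key-injective (toℕ-injective a≡a′)
    ...   | refl = +-monoʳ-< (toℕ (key a) * width) (half-mono (side a) t<t′)

  double-x-mono : ∀ {p q} → x p < x q → x (double p) < x (double q)
  double-x-mono {localPoint _ j _ _ dx≤N _ _} {localPoint _ j′ _ _ dx′≤N _ _} = coord-mono (λ j → j) (λ eq → eq) column dx≤N dx′≤N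

  double-y-mono : ∀ {p q} → y p < y q → y (double p) < y (double q)
  double-y-mono {localPoint i _ _ _ _ dy≤N _} {localPoint i′ _ _ _ _ dy′≤N _} = coord-mono opposite opposite-injective row dy≤N dy′≤N

  double-x-injective : ∀ {p q} → x (double p) ≡ x (double q) → x p ≡ x q
  double-x-injective {localPoint _ j dx _ dx≤N _ _} {localPoint _ j′ dx′ _ dx′≤N _ _} eq
    with coord-injective {toℕ j} {toℕ j′} {column j} {column j′} dx≤N dx′≤N eq
  ... | j≡j′ , _ , dx≡dx′ = cong₂ (λ a t → a * N + t) j≡j′ dx≡dx′

  double-y-injective : ∀ {p q} → y (double p) ≡ y (double q) → y p ≡ y q
  double-y-injective {localPoint i _ _ dy _ dy≤N _} {localPoint i′ _ _ dy′ _ dy′≤N _} eq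
    with coord-injective {toℕ (opposite i)} {toℕ (opposite i′)} {row i} {row i′} dy≤N dy′≤N eq
  ... | i≡i′ , _ , dy≡dy′ = cong₂ (λ a t → a * N + t) i≡i′ dy≡dy′

  mirror-x-injective : ∀ {p q} → x (mirror p) ≡ x (mirror q) → x p ≡ x q
  mirror-x-injective {p} {q} eq = double-x-injective {p} {q} (+-cancelˡ-≡ (x (mirror p)) (x (double p)) (x (double q))
    (trans (mirror-x-sum p) (trans (sym (mirror-x-sum q)) (cong (_+ x (double q)) (sym eq)))))

  mirror-y-injective : ∀ {p q} → y (mirror p) ≡ y (mirror q) → y p ≡ y q
  mirror-y-injective {p} {q} eq = double-y-injective {p} {q} (+-cancelˡ-≡ (y (mirror p)) (y (double p)) (y (double q))
    (trans (mirror-y-sum p) (trans (sym (mirror-y-sum q)) (cong (_+ y (double q)) (sym eq)))))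

  mirror≢double-x : ∀ p q → x (mirror p) ≢ x (double q)
  mirror≢double-x (localPoint _ j dx _ dx≤N _ _) (localPoint _ j′ dx′ _ dx′≤N _ _) eq
    with coord-injective {toℕ (opposite j)} {toℕ j′} {not (column j)} {column j′} {N ∸ dx} {dx′} (m∸n≤m N dx) dx′≤N eq
  ... | j-eq , side-eq , _ with toℕ-injective j-eq
  ...   | refl = not-¬ refl (sym (trans side-eq (column-opposite j)))

  mirror≢double-y : ∀ p q → y (mirror p) ≢ y (double q)
  mirror≢double-y (localPoint i _ _ dy _ dy≤N _) (localPoint i′ _ _ dy′ _ dy′≤N _) eq
    with coord-injective {toℕ (opposite (opposite i))} {toℕ (opposite i′)} {not (row i)} {row i′} {N ∸ dy} {dy′} (m∸n≤m N dy) dy′≤N eq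
  ... | i-eq , side-eq , _ with opposite-injective (toℕ-injective i-eq)
  ...   | refl = not-¬ refl (sym (trans side-eq (row-opposite i)))

  mirror-left : ∀ p q → x (mirror p) < x (double q) ⇔ MirrorLeft column (j p) (j q)
  mirror-left p@(localPoint _ j dx _ dx≤N _ _) q@(localPoint _ j′ dx′ _ dx′≤N _ _) = mk⇔ to from
    where
    to : x (mirror p) < x (double q) → MirrorLeft column j j′
    to lt with coord-< {toℕ (opposite j)} {toℕ j′} {not (column j)} {column j′} (m∸n≤m N dx) dx′≤N lt
    ... | inj₁ j<j′ = inj₁ j<j′
    ... | inj₂ (j≡j′ , halves<) with toℕ-injective j≡j′
    ...   | refl = inj₂ (refl , trans (column-opposite j)
                              (half-flipped-< (column j) dx′≤N (subst (λ b → half (not (column j)) (N ∸ dx) < half b dx′) (column-opposite j) halves<)))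
    from : MirrorLeft column j j′ → x (mirror p) < x (double q)
    from (inj₁ j<j′) = coord-<-cell (not (column j)) (column j′) dx′ j<j′ (m∸n≤m N dx)
    from (inj₂ (refl , right)) = +-monoʳ-< (toℕ (opposite j) * width)
      (subst₂ (λ b b′ → half (not b) (N ∸ dx) < half b′ dx′) (sym (trans (sym (column-opposite j)) right)) (sym right)
        (half-separated dx′ (m∸n≤m N dx)))

data Side (n : ℕ) : Fin (n + n) → Set where
  left : ∀ k → Side n (k ↑ˡ n)
  right : ∀ k → Side n (n ↑ʳ k)

side : ∀ n (e : Fin (n + n)) → Side n e
side n e with splitAt n e in eq
... | inj₁ k = subst (Side n) (splitAt⁻¹-↑ˡ eq) (left k)
... | inj₂ k = subst (Side n) (splitAt⁻¹-↑ʳ eq) (right k)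

opposite-↑ˡ : ∀ n (k : Fin n) → opposite (k ↑ˡ n) ≡ n ↑ʳ opposite k
opposite-↑ˡ n k = toℕ-injective (begin
  toℕ (opposite (k ↑ˡ n))     ≡⟨ opposite-prop (k ↑ˡ n) ⟩
  n + n ∸ suc (toℕ (k ↑ˡ n))  ≡⟨ cong (λ t → n + n ∸ suc t) (toℕ-↑ˡ k n) ⟩
  n + n ∸ suc (toℕ k)         ≡⟨ +-∸-assoc n (toℕ<n k) ⟩
  n + (n ∸ suc (toℕ k))       ≡⟨ cong (n +_) (opposite-prop k) ⟨
  n + toℕ (opposite k)        ≡⟨ toℕ-↑ʳ n (opposite k) ⟨
  toℕ (n ↑ʳ opposite k)       ∎)
  where open ≡-Reasoning

opposite-↑ʳ : ∀ n (k : Fin n) → opposite (n ↑ʳ k) ≡ opposite k ↑ˡ n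
opposite-↑ʳ n k = begin
  opposite (n ↑ʳ k)                       ≡⟨ cong (λ l → opposite (n ↑ʳ l)) (opposite-involutive k) ⟨
  opposite (n ↑ʳ opposite (opposite k))   ≡⟨ cong opposite (opposite-↑ˡ n (opposite k)) ⟨
  opposite (opposite (opposite k ↑ˡ n))   ≡⟨ opposite-involutive _ ⟩
  opposite k ↑ˡ n                         ∎
  where open ≡-Reasoning

module DoubledPermutation {r c} {A : Matrix r c} (cs : Centrosymmetric A) {column : Fin c → Bool} {row : Fin r → Bool}
               (halving : IsHalving A column row)
               {n} (π : Perm n) (π-perm : IsPerm π) (m : ℕ) (xπ yπ : Fin n → ℕ)
               (x-increasing : ∀ k l → toℕ k < toℕ l → xπ k < xπ l)
               (y-order : ∀ k l → (yπ k < yπ l) ⇔ (toℕ (lookup π k) < toℕ (lookup π l)))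
               (on-figure : ∀ k → OnFigure A (suc m) (xπ k) (yπ k)) where

  N : ℕ
  N = suc m

  open Placement cs halving N
  open LocalPoint

  local : Fin n → LocalPoint A N
  local k = proj₁ (onFigure⇒local (on-figure k))

  x-local : ∀ k → xπ k ≡ x (local k)
  x-local k = proj₁ (proj₂ (onFigure⇒local (on-figure k)))

  y-local : ∀ k → yπ k ≡ y (local k)
  y-local k = proj₂ (proj₂ (onFigure⇒local (on-figure k)))

  xπ-injective : ∀ {k l} → xπ k ≡ xπ l → k ≡ l
  xπ-injective {k} {l} eq with <-cmp (toℕ k) (toℕ l)
  ... | tri< k<l _ _ = ⊥-elim (<-irrefl eq (x-increasing k l k<l))
  ... | tri≈ _ k≡l _ = toℕ-injective k≡l
  ... | tri> _ _ l<k = ⊥-elim (<-irrefl (sym eq) (x-increasing l k l<k))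

  yπ-injective : ∀ {k l} → yπ k ≡ yπ l → k ≡ l
  yπ-injective {k} {l} eq with <-cmp (toℕ (lookup π k)) (toℕ (lookup π l))
  ... | tri< lt _ _ = ⊥-elim (<-irrefl eq (Equivalence.from (y-order k l) lt))
  ... | tri≈ _ πk≡πl _ = π-perm k l (toℕ-injective πk≡πl)
  ... | tri> _ _ gt = ⊥-elim (<-irrefl (sym eq) (Equivalence.from (y-order l k) gt))

  point : Fin (n + n) → LocalPoint A width
  point e = [ double ∘ local , mirror ∘ local ∘ opposite ]′ (splitAt n e)

  point-left : ∀ k → point (k ↑ˡ n) ≡ double (local k)
  point-left k rewrite splitAt-↑ˡ n k n = refl

  point-right : ∀ k → point (n ↑ʳ k) ≡ mirror (local (opposite k))
  point-right k rewrite splitAt-↑ʳ n n k = refl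

  X Y : Fin (n + n) → ℕ
  X = x ∘ point
  Y = y ∘ point

  X-left : ∀ k → X (k ↑ˡ n) ≡ x (double (local k))
  X-left k = cong x (point-left k)

  local-x-injective : ∀ {k l} → x (local k) ≡ x (local l) → k ≡ l
  local-x-injective {k} {l} eq = xπ-injective (trans (x-local k) (trans eq (sym (x-local l))))

  local-y-injective : ∀ {k l} → y (local k) ≡ y (local l) → k ≡ l
  local-y-injective {k} {l} eq = yπ-injective (trans (y-local k) (trans eq (sym (y-local l))))

  X-right : ∀ k → X (n ↑ʳ k) ≡ x (mirror (local (opposite k)))
  X-right k = cong x (point-right k)

  X-injective : Injective _≡_ _≡_ X
  X-injective {e} {e′} = by-sides (side n e) (side n e′)
    where
    by-sides : ∀ {e e′} → Side n e → Side n e′ → X e ≡ X e′ → e ≡ e′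
    by-sides (left k) (left l) eq =
      cong (_↑ˡ n) (local-x-injective (double-x-injective {local k} {local l} (trans (sym (X-left k)) (trans eq (X-left l)))))
    by-sides (left k) (right l) eq =
      ⊥-elim (mirror≢double-x (local (opposite l)) (local k) (trans (sym (X-right l)) (trans (sym eq) (X-left k))))
    by-sides (right k) (left l) eq =
      ⊥-elim (mirror≢double-x (local (opposite k)) (local l) (trans (sym (X-right k)) (trans eq (X-left l))))
    by-sides (right k) (right l) eq = cong (n ↑ʳ_) (opposite-injective (local-x-injective
      (mirror-x-injective {local (opposite k)} {local (opposite l)} (trans (sym (X-right k)) (trans eq (X-right l))))))

  Y-left : ∀ k → Y (k ↑ˡ n) ≡ y (double (local k))
  Y-left k = cong y (point-left k)

  Y-right : ∀ k → Y (n ↑ʳ k) ≡ y (mirror (local (opposite k)))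
  Y-right k = cong y (point-right k)

  Y-injective : Injective _≡_ _≡_ Y
  Y-injective {e} {e′} = by-sides (side n e) (side n e′)
    where
    by-sides : ∀ {e e′} → Side n e → Side n e′ → Y e ≡ Y e′ → e ≡ e′
    by-sides (left k) (left l) eq =
      cong (_↑ˡ n) (local-y-injective (double-y-injective {local k} {local l} (trans (sym (Y-left k)) (trans eq (Y-left l)))))
    by-sides (left k) (right l) eq =
      ⊥-elim (mirror≢double-y (local (opposite l)) (local k) (trans (sym (Y-right l)) (trans (sym eq) (Y-left k))))
    by-sides (right k) (left l) eq =
      ⊥-elim (mirror≢double-y (local (opposite k)) (local l) (trans (sym (Y-right k)) (trans eq (Y-left l))))
    by-sides (right k) (right l) eq = cong (n ↑ʳ_) (opposite-injective (local-y-injective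
      (mirror-y-injective {local (opposite k)} {local (opposite l)} (trans (sym (Y-right k)) (trans eq (Y-right l))))))

  coordinate-sum : ∀ (f : LocalPoint A width → ℕ) {S} → (∀ p → f (mirror p) + f (double p) ≡ S) →
                   ∀ e → f (point (opposite e)) + f (point e) ≡ S
  coordinate-sum f {S} sum e = by-side (side n e)
    where
    open ≡-Reasoning
    by-side : ∀ {e} → Side n e → f (point (opposite e)) + f (point e) ≡ S
    by-side (left k) = begin
      f (point (opposite (k ↑ˡ n))) + f (point (k ↑ˡ n))           ≡⟨ cong (λ e → f (point e) + f (point (k ↑ˡ n))) (opposite-↑ˡ n k) ⟩
      f (point (n ↑ʳ opposite k)) + f (point (k ↑ˡ n))             ≡⟨ cong₂ (λ p q → f p + f q) (point-right (opposite k)) (point-left k) ⟩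
      f (mirror (local (opposite (opposite k)))) + f (double (local k)) ≡⟨ cong (λ l → f (mirror (local l)) + f (double (local k))) (opposite-involutive k) ⟩
      f (mirror (local k)) + f (double (local k))                  ≡⟨ sum (local k) ⟩
      S                                                            ∎
    by-side (right k) = begin
      f (point (opposite (n ↑ʳ k))) + f (point (n ↑ʳ k))           ≡⟨ cong (λ e → f (point e) + f (point (n ↑ʳ k))) (opposite-↑ʳ n k) ⟩
      f (point (opposite k ↑ˡ n)) + f (point (n ↑ʳ k))             ≡⟨ cong₂ (λ p q → f p + f q) (point-left (opposite k)) (point-right k) ⟩
      f (double (local (opposite k))) + f (mirror (local (opposite k))) ≡⟨ +-comm (f (double (local (opposite k)))) _ ⟩
      f (mirror (local (opposite k))) + f (double (local (opposite k))) ≡⟨ sum (local (opposite k)) ⟩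
      S                                                            ∎

  open Flatten X Y X-injective Y-injective

  doubled : Perm (n + n)
  doubled = flatten

  doubled-inGeomRC : InGeomRC A doubled
  doubled-inGeomRC = flatten-inGeom A (N + N + 3) (local⇒onFigure ∘ point) ,
                     flatten-centrosymmetric (coordinate-sum x mirror-x-sum) (coordinate-sum y mirror-y-sum)

  column-of : Fin n → Fin c
  column-of k = j (local k)

  column-of-monotone : Monotone column-of
  column-of-monotone {k} {l} k≤l with m≤n⇒m<n∨m≡n k≤l
  ... | inj₂ k≡l rewrite toℕ-injective k≡l = ≤-refl
  ... | inj₁ k<l with scaled-< (dx≤N (local l)) (subst₂ _<_ (x-local k) (x-local l) (x-increasing k l k<l))
  ...   | inj₁ lt = <⇒≤ lt
  ...   | inj₂ (eq , _) = ≤-reflexive eq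

  position : Fin n → Fin (n + n)
  position k = RX.rank (k ↑ˡ n)

  private
    X-left-mono : ∀ {k l} → toℕ k < toℕ l → X (k ↑ˡ n) < X (l ↑ˡ n)
    X-left-mono {k} {l} k<l = subst₂ _<_ (sym (X-left k)) (sym (X-left l))
      (double-x-mono {local k} {local l} (subst₂ _<_ (x-local k) (x-local l) (x-increasing k l k<l)))

    X-left-reflects : ∀ {k l} → X (k ↑ˡ n) < X (l ↑ˡ n) → toℕ k < toℕ l
    X-left-reflects = mono⇒reflects toℕ (λ k → X (k ↑ˡ n)) toℕ-injective X-left-mono


  toℕ-position : ∀ k → toℕ (position k) ≡ toℕ k + count (λ l → X (n ↑ʳ l) <? X (k ↑ˡ n))
  toℕ-position k = begin
    toℕ (RX.rank (k ↑ˡ n))                                          ≡⟨ RX.toℕ-rank (k ↑ˡ n) ⟩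
    count (RX.below? (k ↑ˡ n))                                      ≡⟨ count-split n (RX.below? (k ↑ˡ n)) ⟩
    count (λ l → X (l ↑ˡ n) <? X (k ↑ˡ n)) + count (λ l → X (n ↑ʳ l) <? X (k ↑ˡ n))
      ≡⟨ cong (_+ count (λ l → X (n ↑ʳ l) <? X (k ↑ˡ n))) originals-before ⟩
    toℕ k + count (λ l → X (n ↑ʳ l) <? X (k ↑ˡ n))                  ∎
    where
    open ≡-Reasoning
    originals-before : count (λ l → X (l ↑ˡ n) <? X (k ↑ˡ n)) ≡ toℕ k
    originals-before = trans (count-cong (λ l → X (l ↑ˡ n) <? X (k ↑ˡ n)) (λ l → toℕ l <? toℕ k) X-left-reflects X-left-mono)
                             (count-prefix k)

  mirror-left-of : ∀ k l → X (n ↑ʳ l) < X (k ↑ˡ n) ⇔ MirrorLeft column (column-of (opposite l)) (column-of k)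
  mirror-left-of k l = mk⇔ (to ∘ subst₂ _<_ (X-right l) (X-left k)) (subst₂ _<_ (sym (X-right l)) (sym (X-left k)) ∘ from)
    where open Equivalence (mirror-left (local (opposite l)) (local k))


  private
    Y-left-mono : ∀ {k l} → yπ k < yπ l → Y (k ↑ˡ n) < Y (l ↑ˡ n)
    Y-left-mono {k} {l} lt = subst₂ _<_ (sym (Y-left k)) (sym (Y-left l))
      (double-y-mono {local k} {local l} (subst₂ _<_ (y-local k) (y-local l) lt))

    Y-left-reflects : ∀ {k l} → Y (k ↑ˡ n) < Y (l ↑ˡ n) → yπ k < yπ l
    Y-left-reflects = mono⇒reflects yπ (λ k → Y (k ↑ˡ n)) yπ-injective Y-left-mono

  doubled-order : ∀ k l → toℕ (lookup doubled (position k)) < toℕ (lookup doubled (position l)) ⇔ (toℕ (lookup π k) < toℕ (lookup π l))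
  doubled-order k l = mk⇔ to from
    where
    to : toℕ (lookup doubled (position k)) < toℕ (lookup doubled (position l)) → toℕ (lookup π k) < toℕ (lookup π l)
    to lt = Equivalence.to (y-order k l) (Y-left-reflects (RY.rank-reflects
      (subst₂ (λ u v → toℕ u < toℕ v) (flatten-at-rank (k ↑ˡ n)) (flatten-at-rank (l ↑ˡ n)) lt)))
    from : toℕ (lookup π k) < toℕ (lookup π l) → toℕ (lookup doubled (position k)) < toℕ (lookup doubled (position l))
    from lt = subst₂ (λ u v → toℕ u < toℕ v) (sym (flatten-at-rank (k ↑ˡ n))) (sym (flatten-at-rank (l ↑ˡ n)))
      (RY.rank-mono (Y-left-mono (Equivalence.from (y-order k l) lt)))

module _ {r c} {A : Matrix r c} (cs : Centrosymmetric A) {column : Fin c → Bool} {row : Fin r → Bool}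
         (halving : IsHalving A column row) where

  doubling : ∀ {n} (π : Perm n) → InGeom A π → Perm (n + n) × Vec (Fin (suc n)) c
  doubling π (π-perm , m , xπ , yπ , x-increasing , y-order , on-figure) = doubled , profile column-of
    where open DoubledPermutation cs halving π π-perm m xπ yπ x-increasing y-order on-figure

  doubling-inGeomRC : ∀ {n} (π : Perm n) (π∈ : InGeom A π) → InGeomRC A (proj₁ (doubling π π∈))
  doubling-inGeomRC π (π-perm , m , xπ , yπ , x-increasing , y-order , on-figure) = doubled-inGeomRC
    where open DoubledPermutation cs halving π π-perm m xπ yπ x-increasing y-order on-figure

  doubling-injective : ∀ {n} (π π′ : Perm n) (π∈ : InGeom A π) (π′∈ : InGeom A π′) → doubling π π∈ ≡ doubling π′ π′∈ → π ≡ π′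
  doubling-injective {n} π π′ (π-perm , m , xπ , yπ , xi , yo , of) (π′-perm , m′ , xπ′ , yπ′ , xi′ , yo′ , of′) same = begin
    π                     ≡⟨ tabulate∘lookup π ⟨
    tabulate (lookup π)   ≡⟨ tabulate-cong (same-order (lookup π) (lookup π′) (λ {a} {b} → π′-perm a b) ordered) ⟩
    tabulate (lookup π′)  ≡⟨ tabulate∘lookup π′ ⟩
    π′                    ∎
    where
    open ≡-Reasoning
    module D = DoubledPermutation cs halving π π-perm m xπ yπ xi yo of
    module D′ = DoubledPermutation cs halving π′ π′-perm m′ xπ′ yπ′ xi′ yo′ of′
    same-columns : ∀ k → D.column-of k ≡ D′.column-of k
    same-columns = profile-injective D.column-of-monotone D′.column-of-monotone (cong proj₂ same)
    same-mirrors-left : ∀ k l → D.X (n ↑ʳ l) < D.X (k ↑ˡ n) ⇔ D′.X (n ↑ʳ l) < D′.X (k ↑ˡ n)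
    same-mirrors-left k l = mk⇔
      (Equivalence.from (D′.mirror-left-of k l) ∘ subst₂ (MirrorLeft column) (same-columns (opposite l)) (same-columns k)
        ∘ Equivalence.to (D.mirror-left-of k l))
      (Equivalence.from (D.mirror-left-of k l) ∘ subst₂ (MirrorLeft column) (sym (same-columns (opposite l))) (sym (same-columns k))
        ∘ Equivalence.to (D′.mirror-left-of k l))
    same-position : ∀ k → D.position k ≡ D′.position k
    same-position k = toℕ-injective (begin
      toℕ (D.position k)                                          ≡⟨ D.toℕ-position k ⟩
      toℕ k + count (λ l → D.X (n ↑ʳ l) <? D.X (k ↑ˡ n))          ≡⟨ cong (toℕ k +_) (count-cong (λ l → D.X (n ↑ʳ l) <? D.X (k ↑ˡ n))
                                                                       (λ l → D′.X (n ↑ʳ l) <? D′.X (k ↑ˡ n))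
                                                                       (λ {l} → Equivalence.to (same-mirrors-left k l))
                                                                       (λ {l} → Equivalence.from (same-mirrors-left k l))) ⟩
      toℕ k + count (λ l → D′.X (n ↑ʳ l) <? D′.X (k ↑ˡ n))        ≡⟨ D′.toℕ-position k ⟨
      toℕ (D′.position k)                                         ∎)
    ordered : ∀ {a b} → toℕ (lookup π′ a) < toℕ (lookup π′ b) → toℕ (lookup π a) < toℕ (lookup π b)
    ordered {a} {b} lt = Equivalence.to (D.doubled-order a b)
      (subst₂ (λ p q → toℕ (lookup D.doubled p) < toℕ (lookup D.doubled q)) (sym (same-position a)) (sym (same-position b))
        (subst (λ σ → toℕ (lookup σ (D′.position a)) < toℕ (lookup σ (D′.position b))) (sym (cong proj₁ same))
          (Equivalence.from (D′.doubled-order a b) lt)))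

Eventually : (ℕ → Set) → Set
Eventually P = ∃ λ N → ∀ n → N ≤ n → P n

eventually-both : ∀ {P Q : ℕ → Set} → Eventually P → Eventually Q → Eventually (λ n → P n × Q n)
eventually-both (N , p) (M , q) = N ⊔ M , λ n N⊔M≤n → p n (≤-trans (m≤m⊔n N M) N⊔M≤n) , q n (≤-trans (m≤n⊔m N M) N⊔M≤n)

*-distrib-^ : ∀ x y n → (x * y) ^ n ≡ x ^ n * y ^ n
*-distrib-^ x y zero = refl
*-distrib-^ x y (suc n) = trans (cong (x * y *_) (*-distrib-^ x y n)) (interchange x y (x ^ n) (y ^ n))
  where
  interchange : ∀ x y a b → x * y * (a * b) ≡ x * a * (y * b)
  interchange = solve-∀

^-cancel-2 : ∀ n {u v} → 2 ^ n * u ≤ 2 ^ n * v → u ≤ v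
^-cancel-2 n = *-cancelˡ-≤ (2 ^ n) {{m^n≢0 2 n}}

-- (1 + 1/x)^n ≥ 1 + n/x, multiplied by x^(n+1).
bernoulli : ∀ x n → x ^ n * (x + n) ≤ x * suc x ^ n
bernoulli x zero = ≤-reflexive (base x)
  where
  base : ∀ x → 1 * (x + 0) ≡ x * 1
  base = solve-∀
bernoulli x (suc n) = begin
  x * x ^ n * (x + suc n)                ≡⟨ expand x (x ^ n) n ⟩
  x ^ n * (x + n) * x + x ^ n * x        ≤⟨ +-monoʳ-≤ (x ^ n * (x + n) * x) (*-monoʳ-≤ (x ^ n) (m≤m+n x n)) ⟩
  x ^ n * (x + n) * x + x ^ n * (x + n)  ≡⟨ collect (x ^ n * (x + n)) x ⟩
  x ^ n * (x + n) * suc x                ≤⟨ *-monoˡ-≤ (suc x) (bernoulli x n) ⟩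
  x * suc x ^ n * suc x                  ≡⟨ *-assoc x (suc x ^ n) (suc x) ⟩
  x * (suc x ^ n * suc x)                ≡⟨ cong (x *_) (*-comm (suc x ^ n) (suc x)) ⟩
  x * (suc x * suc x ^ n)                ∎
  where
  open ≤-Reasoning
  expand : ∀ x a n → x * a * (x + suc n) ≡ a * (x + n) * x + a * x
  expand = solve-∀
  collect : ∀ b x → b * x + b ≡ b * suc x
  collect = solve-∀

-- With A = 2a and M = A + 1: 2^n a^n (n+1) ≤ A M^n ≤ (M + 1)^n ≤ (2b)^n once n ≥ M A.
linear-below-exp : ∀ {a b} → a < b → Eventually λ n → a ^ n * suc n ≤ b ^ n
linear-below-exp {zero} {b} _ = 1 , λ where (suc n) _ → z≤n
linear-below-exp {a@(suc _)} {b} a<b = M * A , bound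
  where
  A M : ℕ
  A = 2 * a
  M = suc A
  open ≤-Reasoning
  bound : ∀ n → M * A ≤ n → a ^ n * suc n ≤ b ^ n
  bound n MA≤n = ^-cancel-2 n (begin
    2 ^ n * (a ^ n * suc n)    ≡⟨ *-assoc (2 ^ n) (a ^ n) (suc n) ⟨
    2 ^ n * a ^ n * suc n      ≡⟨ cong (_* suc n) (*-distrib-^ 2 a n) ⟨
    A ^ n * suc n              ≤⟨ *-monoʳ-≤ (A ^ n) (+-monoˡ-≤ n (≤-trans (s≤s z≤n) (*-monoʳ-≤ 2 (s≤s z≤n)))) ⟩
    A ^ n * (A + n)            ≤⟨ bernoulli A n ⟩
    A * M ^ n                  ≤⟨ *-cancelˡ-≤ M (begin
                                    M * (A * M ^ n)   ≡⟨ rearrange M A (M ^ n) ⟩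
                                    M ^ n * (M * A)   ≤⟨ *-monoʳ-≤ (M ^ n) (≤-trans MA≤n (m≤n+m n M)) ⟩
                                    M ^ n * (M + n)   ≤⟨ bernoulli M n ⟩
                                    M * suc M ^ n     ∎) ⟩
    suc M ^ n                  ≤⟨ ^-monoˡ-≤ n (≤-trans (≤-reflexive (two-steps a)) (*-monoʳ-≤ 2 a<b)) ⟩
    (2 * b) ^ n                ≡⟨ *-distrib-^ 2 b n ⟩
    2 ^ n * b ^ n              ∎)
    where
    rearrange : ∀ M A c → M * (A * c) ≡ c * (M * A)
    rearrange = solve-∀
    two-steps : ∀ a → suc (suc (2 * a)) ≡ 2 * suc a
    two-steps = solve-∀

-- Each factor n + 1 is absorbed by the step 2a < 2a + 1 < 2b.
poly-below-exp : ∀ c {a b} → a < b → Eventually λ n → a ^ n * suc n ^ c ≤ b ^ n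
poly-below-exp zero {a} {b} a<b = 0 , λ n _ → ≤-trans (≤-reflexive (*-identityʳ (a ^ n))) (^-monoˡ-≤ n (<⇒≤ a<b))
poly-below-exp (suc c) {a} {b} a<b with eventually-both (poly-below-exp c (n<1+n (2 * a))) (linear-below-exp (odd<even a<b))
  where
  odd<even : ∀ {a b} → a < b → suc (2 * a) < 2 * b
  odd<even {a} a<b = ≤-trans (≤-reflexive (two-steps a)) (*-monoʳ-≤ 2 a<b)
    where
    two-steps : ∀ a → suc (suc (2 * a)) ≡ 2 * suc a
    two-steps = solve-∀
... | N , both = N , bound
  where
  open ≤-Reasoning
  bound : ∀ n → N ≤ n → a ^ n * (suc n * suc n ^ c) ≤ b ^ n
  bound n N≤n with both n N≤n
  ... | poly , linear = ^-cancel-2 n (begin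
    2 ^ n * (a ^ n * (suc n * suc n ^ c))    ≡⟨ regroup (2 ^ n) (a ^ n) (suc n) (suc n ^ c) ⟩
    2 ^ n * a ^ n * suc n ^ c * suc n        ≡⟨ cong (λ z → z * suc n ^ c * suc n) (*-distrib-^ 2 a n) ⟨
    (2 * a) ^ n * suc n ^ c * suc n          ≤⟨ *-monoˡ-≤ (suc n) poly ⟩
    suc (2 * a) ^ n * suc n                  ≤⟨ linear ⟩
    (2 * b) ^ n                              ≡⟨ *-distrib-^ 2 b n ⟩
    2 ^ n * b ^ n                            ∎)
    where
    regroup : ∀ t x y z → t * (x * (y * z)) ≡ t * x * z * y
    regroup = solve-∀

cross-multiply : ∀ {P Q P′ Q′ M S k} → 0 < P′ → 0 < Q′ → 0 < M →
                 P * Q′ * M ≤ P′ * Q → P′ ≤ Q′ * k → k ≤ S * M → P ≤ Q * S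
cross-multiply {P} {Q} {P′} {Q′} {M} {S} {k} P′>0 Q′>0 M>0 PQ′M≤P′Q P′≤Q′k k≤SM =
  *-cancelʳ-≤ P (Q * S) (P′ * Q′ * M) {{>-nonZero (*-mono-< (*-mono-< P′>0 Q′>0) M>0)}} (begin
    P * (P′ * Q′ * M)        ≡⟨ shuffle₁ P P′ Q′ M ⟩
    P * Q′ * M * P′          ≤⟨ *-monoˡ-≤ P′ PQ′M≤P′Q ⟩
    P′ * Q * P′              ≤⟨ *-monoʳ-≤ (P′ * Q) (≤-trans P′≤Q′k (*-monoʳ-≤ Q′ k≤SM)) ⟩
    P′ * Q * (Q′ * (S * M))  ≡⟨ shuffle₂ P′ Q Q′ S M ⟩
    Q * S * (P′ * Q′ * M)    ∎)
  where
  open ≤-Reasoning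
  shuffle₁ : ∀ P P′ Q′ M → P * (P′ * Q′ * M) ≡ P * Q′ * M * P′
  shuffle₁ = solve-∀
  shuffle₂ : ∀ P′ Q Q′ S M → P′ * Q * (Q′ * (S * M)) ≡ Q * S * (P′ * Q′ * M)
  shuffle₂ = solve-∀

doubling-count : ∀ {r c} {A : Matrix r c} → Centrosymmetric A → ∀ {column row} → IsHalving A column row →
                 ∀ {n k} → AtLeast {n} (InGeom A) k → ∃ λ K → AtLeast {n + n} (InGeomRC A) K × k ≤ K * suc n ^ c
doubling-count {c = c} {A} cs is-halving {n} {k} (L , L-unique , L-geometric , k≤|L|) =
  counted (injection-bound (Vec-≡-dec _≟_) (λ {π} → doubling cs is-halving π) (λ {π} {π′} → doubling-injective cs is-halving π π′)
                           (λ {π} → doubling-inGeomRC cs is-halving π) (∈-vectors ∈-allFin) L-unique L-geometric)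
  where
  profiles : length (vectors (allFin (suc n)) c) ≡ suc n ^ c
  profiles = trans (length-vectors (allFin (suc n)) c) (cong (_^ c) (length-tabulate (λ i → i)))
  counted : (Σ (List (Perm (n + n))) λ K → Unique K × All (InGeomRC A) K × length L ≤ length K * length (vectors (allFin (suc n)) c)) →
            ∃ λ K → AtLeast {n + n} (InGeomRC A) K × k ≤ K * suc n ^ c
  counted (K , K-unique , K-rc , |L|≤) =
    length K , (K , K-unique , K-rc , ≤-refl) , ≤-trans k≤|L| (subst (λ v → length L ≤ length K * v) profiles |L|≤)

centrosymmetric-count : ∀ {r c} {A : Matrix r c} → Centrosymmetric A → CellGraphIsForest A →
                        ∀ {n k} → AtLeast {n} (InGeom A) k → ∃ λ K → AtLeast {n + n} (InGeomRC A) K × k ≤ K * suc n ^ c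
centrosymmetric-count {c = c} {A} cs forest = from-halving (halving A cs forest)
  where
  from-halving : (∃ λ column → ∃ λ row → IsHalving A column row) →
                 ∀ {n k} → AtLeast {n} (InGeom A) k → ∃ λ K → AtLeast {n + n} (InGeomRC A) K × k ≤ K * suc n ^ c
  from-halving (_ , _ , is-halving) = doubling-count cs is-halving

theorem1p2 : ∀ {r c : ℕ} (A : Matrix r c) → Centrosymmetric A → CellGraphIsForest A →
    ∀ (p q p' q' : ℕ) → 0 < q → 0 < q' → p * q' < p' * q →
    (∃ λ (N : ℕ) → ∀ (n : ℕ) → N ≤ n →
       ∃ λ (k : ℕ) → p' ^ n ≤ q' ^ n * k × AtLeast {n} (InGeom A) k) →
    ∃ λ (N : ℕ) → ∀ (n : ℕ) → N ≤ n →
       ∃ λ (k : ℕ) → p ^ n ≤ q ^ n * k × AtLeast {n + n} (InGeomRC A) k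
theorem1p2 {c = c} A cs forest p q p′ q′ _ q′>0 pq′<p′q many =
  proj₁ eventually , λ n N≤n → bound n (proj₂ eventually n N≤n)
  where
  eventually : Eventually λ n → (∃ λ k → p′ ^ n ≤ q′ ^ n * k × AtLeast {n} (InGeom A) k) × (p * q′) ^ n * suc n ^ c ≤ (p′ * q) ^ n
  eventually = eventually-both many (poly-below-exp c pq′<p′q)
  p′>0 : 0 < p′
  p′>0 = n≢0⇒n>0 λ { refl → n≮0 pq′<p′q }
  bound : ∀ n → (∃ λ k → p′ ^ n ≤ q′ ^ n * k × AtLeast {n} (InGeom A) k) × (p * q′) ^ n * suc n ^ c ≤ (p′ * q) ^ n →
          ∃ λ k → p ^ n ≤ q ^ n * k × AtLeast {n + n} (InGeomRC A) k
  bound n ((k , p′ⁿ≤q′ⁿk , geometric) , below) = from-count (centrosymmetric-count cs forest geometric)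
    where
    from-count : (∃ λ K → AtLeast {n + n} (InGeomRC A) K × k ≤ K * suc n ^ c) → ∃ λ K → p ^ n ≤ q ^ n * K × AtLeast {n + n} (InGeomRC A) K
    from-count (K , centrosymmetric , k≤KM) =
      K , cross-multiply (m^n>0 p′ {{>-nonZero p′>0}} n) (m^n>0 q′ {{>-nonZero q′>0}} n) (m^n>0 (suc n) c)
            (subst₂ (λ a b → a * suc n ^ c ≤ b) (*-distrib-^ p q′ n) (*-distrib-^ p′ q n) below) p′ⁿ≤q′ⁿk k≤KM ,
          centrosymmetric
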